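{- The linear map $\Psi^*:\mathrm{NSym}\to\mathbf{ISPW}$ defined by $\Psi^*(1)=1$ and, for $n\ge1$ and $(k_1,\dots,k_n)\in(\mathbb{N}^*)^n$, $$\Psi^*(M^*_{(k_1,\dots,k_n)})=\sum_{i=n}^{k_1+\dots+k_n}\ \sum_{\substack{s_1+\dots+s_n=i\\1\le s_j\le k_j}}\ \sum_{\substack{(u^{(1)}_1,\dots,u^{(1)}_{s_1})\models k_1\\\vdots\\(u^{(n)}_1,\dots,u^{(n)}_{s_n})\models k_n}}\frac{1}{s_1!\cdots s_n!}\,W_{(u^{(1)}_1,\dots,u^{(1)}_{s_1},\dots,u^{(n)}_1,\dots,u^{(n)}_{s_n})},$$ is an isomorphism of Hopf algebras.
   Context: $\mathbb{K}$ is a field of characteristic $0$. $(u_1,\dots,u_s)\models k$ means $(u_1,\dots,u_s)$ is a composition of $k$. For a composition $\beta=(\beta_1,\dots,\beta_p)$, $W_\beta$ is the word $x_1^{\beta_1}\cdots x_p^{\beta_p}$ ($\beta_1$ letters $x_1$, then $\beta_2$ letters $x_2$, …). $\mathbf{ISPW}$ has basis $(W_\beta)$ (with $W_{()}=1$), product $W_\alpha\ast W_\beta=W_{\alpha\beta}$ (concatenation of compositions) and coproduct $\Delta(W_{(\beta_1,\dots,\beta_p)})=\sum_{I\sqcup U=\{1,\dots,p\}}W_{(\beta_i)_{i\in I}}\otimes W_{(\beta_u)_{u\in U}}$ (indices in increasing order). $\mathrm{NSym}$ is the graded dual of the Hopf algebra $\mathrm{QSym}$ of quasi-symmetric functions (spanned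 by $M_\alpha=\sum_{i_1<\dots<i_k}y_{i_1}^{\alpha_1}\cdots y_{i_k}^{\alpha_k}$ with usual product and deconcatenation coproduct), and $(M^*_\alpha)$ is the basis dual to $(M_\alpha)$; its product is $M^*_\alpha M^*_\beta=M^*_{\alpha\beta}$ and $\Delta(M^*_{(n)})=\sum_{s=0}^nM^*_{(s)}\otimes M^*_{(n-s)}$ with $M^*_{(0)}=1$. -}

module Defs where

open import Level using (Level; _⊔_) renaming (suc to lsuc)
open import Algebra.Bundles using (CommutativeRing)
open import Data.Nat as ℕ using (ℕ; zero; suc; _∸_; _!)
open import Data.List using (List; []; _∷_; _++_; map; concatMap; concat; filter; length; upTo; foldr; zipWith)
open import Data.Product using (Σ; _×_; _,_; proj₁; proj₂)
open import Data.Bool using (true; false)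
open import Relation.Nullary using (¬_; Dec; yes; no; does)
open import Relation.Binary.PropositionalEquality using (_≡_; refl; cong)
open import Relation.Binary.Definitions using (DecidableEquality)
import Data.List.Properties as LP
import Data.Product.Properties as PP

module _ {c ℓ : Level} (R : CommutativeRing c ℓ) where
  open CommutativeRing R
  ι : ℕ → Carrier
  ι zero    = 0#
  ι (suc n) = 1# + ι n

record CharZeroField (c ℓ : Level) : Set (lsuc (c ⊔ ℓ)) where
  field
    commutativeRing : CommutativeRing c ℓ
  open CommutativeRing commutativeRing public
  field
    0≉1       : ¬ (0# ≈ 1#)
    inverse   : ∀ x → ¬ (x ≈ 0#) → Σ Carrier (λ y → x * y ≈ 1#)
    charZero  : ∀ n → ¬ (ι commutativeRing (suc n) ≈ 0#)

-- Compositions: lists of positive integers.  A part is written  1+ n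
-- and stands for the positive integer  suc n.

record ℕ⁺ : Set where
  constructor 1+_
  field pred : ℕ

⟦_⟧ : ℕ⁺ → ℕ
⟦ 1+ n ⟧ = suc n

_≟⁺_ : DecidableEquality ℕ⁺
(1+ m) ≟⁺ (1+ n) with m ℕ.≟ n
... | yes refl = yes refl
... | no m≢n = no λ { refl → m≢n refl }

Comp : Set
Comp = List ℕ⁺

_≟C_ : DecidableEquality Comp
_≟C_ = LP.≡-dec _≟⁺_

_≟C²_ : DecidableEquality (Comp × Comp)
_≟C²_ = PP.≡-dec _≟C_ _≟C_

size : Comp → ℕ
size α = foldr (λ p n → ⟦ p ⟧ ℕ.+ n) 0 α

-- all compositions of  suc n  (head-first: prepend a part 1, or enlarge the first part)
compsSuc : ℕ → List Comp
compsSuc zero    = (1+ 0 ∷ []) ∷ []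
compsSuc (suc n) = concatMap (λ c → (1+ 0 ∷ c) ∷ incHead c ∷ []) (compsSuc n)
  where
  incHead : Comp → Comp
  incHead []           = []
  incHead (1+ p ∷ ps)  = 1+ suc p ∷ ps

comps : ℕ → List Comp
comps zero    = [] ∷ []
comps (suc n) = compsSuc n

compsWithParts : ℕ → ℕ → List Comp
compsWithParts k s = filter (λ u → length u ℕ.≟ s) (comps k)

range : ℕ → ℕ → List ℕ
range a b = map (a ℕ.+_) (upTo (suc (b ∸ a)))

cartesian : ∀ {a} {A : Set a} → List (List A) → List (List A)
cartesian []         = [] ∷ []
cartesian (xs ∷ xss) = concatMap (λ x → map (x ∷_) (cartesian xss)) xs

sumℕ : List ℕ → ℕ
sumℕ = foldr ℕ._+_ 0

-- Quasi-shuffle: the multiset of compositions γ such that M_α M_β = Σ_γ M_γ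
-- in QSym (product of monomial quasi-symmetric functions), with multiplicity.

qsh : Comp → Comp → List Comp
qsh []       β        = β ∷ []
qsh (x ∷ α)  []       = (x ∷ α) ∷ []
qsh (x ∷ α)  (y ∷ β)  =
     map (x ∷_) (qsh α (y ∷ β))
  ++ map (y ∷_) (qsh (x ∷ α) β)
  ++ map ((1+ (ℕ.pred ⟦ x ⟧ ℕ.+ ⟦ y ⟧)) ∷_) (qsh α β)

countC : Comp → List Comp → ℕ
countC γ []       = 0
countC γ (δ ∷ δs) with does (γ ≟C δ)
... | true  = suc (countC γ δs)
... | false = countC γ δs

splits : Comp → List (Comp × Comp)
splits []       = ([] , []) ∷ []
splits (x ∷ xs) = concatMap (λ { (l , r) → (x ∷ l , r) ∷ (l , x ∷ r) ∷ [] }) (splits xs)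

module Hopf {c ℓ : Level} (F : CharZeroField c ℓ) where
  open CharZeroField F

  Lin : Set → Set c
  Lin X = List (Carrier × X)

  coeff : {X : Set} → DecidableEquality X → Lin X → X → Carrier
  coeff _≟_ []             x = 0#
  coeff _≟_ ((a , y) ∷ v)  x with does (y ≟ x)
  ... | true  = a + coeff _≟_ v x
  ... | false = coeff _≟_ v x

  scale : {X : Set} → Carrier → Lin X → Lin X
  scale a = map (λ { (b , x) → (a * b , x) })

  -- Elements of NSym (basis M*_α) and of ISPW (basis W_β) are both
  -- represented as finite linear combinations of compositions.
  NSym ISPW : Set c
  NSym = Lin Comp
  ISPW = Lin Comp

  NSym⊗NSym ISPW⊗ISPW : Set c
  NSym⊗NSym = Lin (Comp × Comp)
  ISPW⊗ISPW = Lin (Comp × Comp)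

  infix 4 _≋_ _≋⊗_
  _≋_ : Lin Comp → Lin Comp → Set ℓ
  v ≋ w = ∀ γ → coeff _≟C_ v γ ≈ coeff _≟C_ w γ

  _≋⊗_ : Lin (Comp × Comp) → Lin (Comp × Comp) → Set ℓ
  v ≋⊗ w = ∀ γ → coeff _≟C²_ v γ ≈ coeff _≟C²_ w γ

  bilin : {X Y Z : Set} → (X → Y → Lin Z) → Lin X → Lin Y → Lin Z
  bilin f v w = concatMap (λ { (a , x) → concatMap (λ { (b , y) → scale (a * b) (f x y) }) w }) v

  linext : {X Y : Set} → (X → Lin Y) → Lin X → Lin Y
  linext f = concatMap (λ { (a , x) → scale a (f x) })

  -- NSym: unit, product M*_α M*_β = M*_{αβ}, counit,
  -- coproduct dual to the product of QSym:
  --   Δ(M*_γ) = Σ_{α,β} ⟨M_α M_β , M*_γ⟩ M*_α ⊗ M*_β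
  unitN : NSym
  unitN = (1# , []) ∷ []

  mulN : NSym → NSym → NSym
  mulN = bilin (λ α β → (1# , α ++ β) ∷ [])

  counitN : NSym → Carrier
  counitN v = coeff _≟C_ v []

  ΔN-basis : Comp → NSym⊗NSym
  ΔN-basis γ =
    concatMap (λ a →
      concatMap (λ α →
        map (λ β → (ι commutativeRing (countC γ (qsh α β)) , (α , β)))
            (comps (size γ ∸ a)))
        (comps a))
      (range 0 (size γ))

  ΔN : NSym → NSym⊗NSym
  ΔN = linext ΔN-basis

  unitW : ISPW
  unitW = (1# , []) ∷ []

  mulW : ISPW → ISPW → ISPW
  mulW = bilin (λ α β → (1# , α ++ β) ∷ [])

  counitW : ISPW → Carrier
  counitW v = coeff _≟C_ v []

  ΔW : ISPW → ISPW⊗ISPW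
  ΔW = linext (λ β → map (λ p → (1# , p)) (splits β))

  -- 1 / n  for n ≥ 1  (and an irrelevant value at n = 0)
  inv : ℕ → Carrier
  inv zero    = 0#
  inv (suc m) = proj₁ (inverse (ι commutativeRing (suc m)) (charZero m))

  invFact : ℕ → Carrier
  invFact s = inv (s !)

  prodK : List Carrier → Carrier
  prodK = foldr _*_ 1#

  Ψ*-basis : Comp → ISPW
  Ψ*-basis []  = (1# , []) ∷ []
  Ψ*-basis k@(_ ∷ _) =
    concatMap (λ i →
      concatMap (λ s →
        map (λ us → (prodK (map invFact s) , concat us))
            (cartesian (zipWith compsWithParts ks s)))
        (filter (λ s → sumℕ s ℕ.≟ i)
                (cartesian (map (λ kj → range 1 kj) ks))))
      (range (length k) (sumℕ ks))
    where
    ks : List ℕ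
    ks = map ⟦_⟧ k

  Ψ* : NSym → ISPW
  Ψ* = linext Ψ*-basis

  Ψ*⊗Ψ* : NSym⊗NSym → ISPW⊗ISPW
  Ψ*⊗Ψ* = linext (λ { (α , β) → bilin (λ x y → (1# , (x , y)) ∷ []) (Ψ*-basis α) (Ψ*-basis β) })

-- Identities between formal linear combinations are checked by pairing both sides with an
-- arbitrary test function h, ⟨ h ∣ Σ aᵢ xᵢ ⟩ = Σ aᵢ h xᵢ: two combinations have the same
-- coefficients iff all these pairings agree.  Regrouping the defining sum shows that
-- Ψ*(M*_(k₁,…,kₙ)) = P k₁ ∗ ⋯ ∗ P kₙ with P k = Σ_{u ⊨ k} W_u / ℓ(u)!, so Ψ* is multiplicative
-- and respects unit and counit.  Every term W_β of this product refines α = (k₁,…,kₙ), W_α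
-- itself has coefficient 1, and proper refinement lowers the defect |β| − ℓ(β); so Ψ* is
-- unitriangular and is inverted by recursion on the defect.  For the coproduct, the coefficient
-- of W_α ⊗ W_β in Δ(P k) counts the C(a+b, a) shuffles of α and β (a = ℓ(α), b = ℓ(β)), and
-- C(a+b, a) / (a+b)! = 1 / (a! b!), whence Δ(P k) = P k ⊗ 1 + 1 ⊗ P k + Σ_{i+j=k} P i ⊗ P j.
-- Multiplicativity of Δ then expands Δ(Ψ*(M*_γ)) over the ways of sending each part of γ to the
-- left, to the right, or splitting it between both sides; these are exactly the pairs (α, β)
-- whose quasi-shuffles produce γ, counted with multiplicity, i.e. the terms of Δ(M*_γ).

module Submission where

open import Defs
open import Level using (Level)
open import Algebra.Bundles using (CommutativeRing)
open import Data.Bool using (Bool; true; false; if_then_else_)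
open import Data.Empty using (⊥-elim)
open import Data.List using (List; []; _∷_; _++_; map; concatMap; concat; filter; length; zipWith; upTo; applyUpTo)
import Data.List.Properties as ListP
open import Data.List.Relation.Unary.All as All using (All; []; _∷_)
import Data.List.Relation.Unary.All.Properties as AllP
open import Data.Nat as ℕ using (ℕ; zero; suc; NonZero; _≤_; _<_; _∸_; _!; z≤n; s≤s)
import Data.Nat.Properties as ℕP
open import Data.Nat.Tactic.RingSolver using (solve-∀)
open import Data.Product using (Σ; _×_; _,_; proj₁; proj₂)
open import Function using (_∘_; _∘′_)
open import Function.Bundles using (mk⇔)
open import Relation.Nullary using (¬_; Dec; yes; no; does; ¬?)
open import Relation.Nullary.Decidable using (does-⇔; dec-true)
open import Relation.Binary.Definitions using (DecidableEquality)
open import Relation.Binary.PropositionalEquality as ≡ using (_≡_)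

module _ {a} {A : Set a} where
  open ≡.≡-Reasoning

  shuffles : List A → List A → List (List A)
  shuffles []       ys       = ys ∷ []
  shuffles (x ∷ xs) []       = (x ∷ xs) ∷ []
  shuffles (x ∷ xs) (y ∷ ys) = map (x ∷_) (shuffles xs (y ∷ ys)) ++ map (y ∷_) (shuffles (x ∷ xs) ys)

  shuffles-[]ʳ : ∀ xs → shuffles xs [] ≡ xs ∷ []
  shuffles-[]ʳ []       = ≡.refl
  shuffles-[]ʳ (x ∷ xs) = ≡.refl

  length-shuffles : ∀ xs ys → length (shuffles xs ys) ℕ.* length xs ! ℕ.* length ys ! ≡ (length xs ℕ.+ length ys) !
  length-shuffles []       ys = ℕP.+-identityʳ _
  length-shuffles (x ∷ xs) [] rewrite ℕP.+-identityʳ (length xs) = ≡.trans (ℕP.*-identityʳ _) (ℕP.+-identityʳ _)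
  length-shuffles (x ∷ xs) (y ∷ ys) = begin
    length (map (x ∷_) L ++ map (y ∷_) R) ℕ.* (suc m ℕ.* m !) ℕ.* (suc n ℕ.* n !)
      ≡⟨ ≡.cong (λ k → k ℕ.* (suc m ℕ.* m !) ℕ.* (suc n ℕ.* n !)) length-L++R ⟩
    (length L ℕ.+ length R) ℕ.* (suc m ℕ.* m !) ℕ.* (suc n ℕ.* n !)
      ≡⟨ regroup (length L) (length R) (suc m) (m !) (suc n) (n !) ⟩
    suc m ℕ.* (length L ℕ.* m ! ℕ.* (suc n ℕ.* n !)) ℕ.+ suc n ℕ.* (length R ℕ.* (suc m ℕ.* m !) ℕ.* n !)
      ≡⟨ ≡.cong₂ (λ p q → suc m ℕ.* p ℕ.+ suc n ℕ.* q)
                 (≡.trans (length-shuffles xs (y ∷ ys)) (≡.cong _! (ℕP.+-suc m n))) (length-shuffles (x ∷ xs) ys) ⟩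
    suc m ℕ.* suc (m ℕ.+ n) ! ℕ.+ suc n ℕ.* suc (m ℕ.+ n) !
      ≡⟨ pascal m n (suc (m ℕ.+ n) !) ⟩
    suc (suc (m ℕ.+ n)) ℕ.* suc (m ℕ.+ n) !
      ≡⟨ ≡.cong (λ k → suc k !) (ℕP.+-suc m n) ⟨
    (suc m ℕ.+ suc n) ! ∎
    where
    m n : ℕ
    m = length xs
    n = length ys
    L R : List (List A)
    L = shuffles xs (y ∷ ys)
    R = shuffles (x ∷ xs) ys
    length-L++R : length (map (x ∷_) L ++ map (y ∷_) R) ≡ length L ℕ.+ length R
    length-L++R = ≡.trans (ListP.length-++ (map (x ∷_) L))
                          (≡.cong₂ ℕ._+_ (ListP.length-map (x ∷_) L) (ListP.length-map (y ∷_) R))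
    regroup : ∀ p q a f b g → (p ℕ.+ q) ℕ.* (a ℕ.* f) ℕ.* (b ℕ.* g) ≡ a ℕ.* (p ℕ.* f ℕ.* (b ℕ.* g)) ℕ.+ b ℕ.* (q ℕ.* (a ℕ.* f) ℕ.* g)
    regroup = solve-∀
    pascal : ∀ p q k → suc p ℕ.* k ℕ.+ suc q ℕ.* k ≡ suc (suc (p ℕ.+ q)) ℕ.* k
    pascal = solve-∀

all-concatMap⁺ : ∀ {a b} {A : Set a} {B : Set b} {P : A → Set} {Q : B → Set} {f : A → List B} {xs : List A} →
                 (∀ {x} → P x → All Q (f x)) → All P xs → All Q (concatMap f xs)
all-concatMap⁺ P⇒Q = AllP.concat⁺ ∘ AllP.map⁺ ∘ All.map P⇒Q

module FiniteSums {c ℓ : Level} (R : CommutativeRing c ℓ) where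
  open CommutativeRing R
  open import Relation.Binary.Reasoning.Setoid setoid
  open import Algebra.Properties.CommutativeSemigroup +-commutativeSemigroup
    using () renaming (interchange to +-interchange)

  χ : Bool → Carrier → Carrier
  χ b a = if b then a else 0#

  ∑ : {a : Level} {A : Set a} → List A → (A → Carrier) → Carrier
  ∑ []       f = 0#
  ∑ (x ∷ xs) f = f x + ∑ xs f

  module _ {a : Level} {A : Set a} where

    ∑-cong : (xs : List A) {f g : A → Carrier} → (∀ x → f x ≈ g x) → ∑ xs f ≈ ∑ xs g
    ∑-cong []       f≈g = refl
    ∑-cong (x ∷ xs) f≈g = +-cong (f≈g x) (∑-cong xs f≈g)

    ∑-congᴬ : {P : A → Set} {xs : List A} {f g : A → Carrier} →
              All P xs → (∀ x → P x → f x ≈ g x) → ∑ xs f ≈ ∑ xs g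
    ∑-congᴬ []         f≈g = refl
    ∑-congᴬ (px ∷ pxs) f≈g = +-cong (f≈g _ px) (∑-congᴬ pxs f≈g)

    ∑-++ : (xs ys : List A) (f : A → Carrier) → ∑ (xs ++ ys) f ≈ ∑ xs f + ∑ ys f
    ∑-++ []       ys f = sym (+-identityˡ _)
    ∑-++ (x ∷ xs) ys f = trans (+-congˡ (∑-++ xs ys f)) (sym (+-assoc _ _ _))

    ∑-zero : (xs : List A) → ∑ xs (λ _ → 0#) ≈ 0#
    ∑-zero []       = refl
    ∑-zero (x ∷ xs) = trans (+-identityˡ _) (∑-zero xs)

    ∑-+ : (xs : List A) (f g : A → Carrier) → ∑ xs (λ x → f x + g x) ≈ ∑ xs f + ∑ xs g
    ∑-+ []       f g = sym (+-identityˡ _)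
    ∑-+ (x ∷ xs) f g = trans (+-congˡ (∑-+ xs f g)) (+-interchange _ _ _ _)

    ∑-*ˡ : (xs : List A) (a : Carrier) (f : A → Carrier) → a * ∑ xs f ≈ ∑ xs (λ x → a * f x)
    ∑-*ˡ []       a f = zeroʳ a
    ∑-*ˡ (x ∷ xs) a f = trans (distribˡ a _ _) (+-congˡ (∑-*ˡ xs a f))

    ∑-*ʳ : (xs : List A) (a : Carrier) (f : A → Carrier) → ∑ xs f * a ≈ ∑ xs (λ x → f x * a)
    ∑-*ʳ xs a f = trans (*-comm _ a) (trans (∑-*ˡ xs a f) (∑-cong xs (λ x → *-comm a (f x))))

    ∑-filter : {P : A → Set} (P? : ∀ x → Dec (P x)) (xs : List A) (f : A → Carrier) →
               ∑ (filter P? xs) f ≈ ∑ xs (λ x → χ (does (P? x)) (f x))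
    ∑-filter P? []       f = refl
    ∑-filter P? (x ∷ xs) f with does (P? x)
    ... | true  = +-congˡ (∑-filter P? xs f)
    ... | false = trans (∑-filter P? xs f) (sym (+-identityˡ _))

    ∑-const : (xs : List A) (a : Carrier) → ∑ xs (λ _ → a) ≈ ι R (length xs) * a
    ∑-const []       a = sym (zeroˡ a)
    ∑-const (x ∷ xs) a = trans (+-cong (sym (*-identityˡ a)) (∑-const xs a)) (sym (distribʳ a _ _))

  module _ {a b : Level} {A : Set a} {B : Set b} where

    ∑-map : (g : A → B) (xs : List A) (f : B → Carrier) → ∑ (map g xs) f ≡ ∑ xs (λ x → f (g x))
    ∑-map g []       f = ≡.refl
    ∑-map g (x ∷ xs) f = ≡.cong (f (g x) +_) (∑-map g xs f)

    ∑-concatMap : (g : A → List B) (xs : List A) (f : B → Carrier) →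
                  ∑ (concatMap g xs) f ≈ ∑ xs (λ x → ∑ (g x) f)
    ∑-concatMap g []       f = refl
    ∑-concatMap g (x ∷ xs) f = trans (∑-++ (g x) (concatMap g xs) f) (+-congˡ (∑-concatMap g xs f))

    ∑-comm : (xs : List A) (ys : List B) (f : A → B → Carrier) →
             ∑ xs (λ x → ∑ ys (f x)) ≈ ∑ ys (λ y → ∑ xs (λ x → f x y))
    ∑-comm []       ys f = sym (∑-zero ys)
    ∑-comm (x ∷ xs) ys f =
      trans (+-congˡ (∑-comm xs ys f)) (sym (∑-+ ys (f x) (λ y → ∑ xs (λ x → f x y))))

  χ-cong : ∀ b {x y} → x ≈ y → χ b x ≈ χ b y
  χ-cong true  x≈y = x≈y
  χ-cong false x≈y = refl

  *-χ : ∀ b x y → x * χ b y ≈ χ b (x * y)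
  *-χ true  x y = refl
  *-χ false x y = zeroʳ x

  χ1-* : ∀ b x → χ b 1# * x ≈ χ b x
  χ1-* true  x = *-identityˡ x
  χ1-* false x = zeroˡ x

  χ-subst : ∀ {X : Set} (_≟_ : DecidableEquality X) x y (f : X → Carrier) →
            χ (does (x ≟ y)) (f y) ≈ χ (does (x ≟ y)) (f x)
  χ-subst _≟_ x y f with x ≟ y
  ... | yes ≡.refl = refl
  ... | no _       = refl

  ι-+ : ∀ m n → ι R (m ℕ.+ n) ≈ ι R m + ι R n
  ι-+ zero    n = sym (+-identityˡ _)
  ι-+ (suc m) n = trans (+-congˡ (ι-+ m n)) (sym (+-assoc _ _ _))

  ι-* : ∀ m n → ι R (m ℕ.* n) ≈ ι R m * ι R n
  ι-* zero    n = sym (zeroˡ _)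
  ι-* (suc m) n = begin
    ι R (n ℕ.+ m ℕ.* n)     ≈⟨ ι-+ n (m ℕ.* n) ⟩
    ι R n + ι R (m ℕ.* n)   ≈⟨ +-cong (sym (*-identityˡ _)) (ι-* m n) ⟩
    1# * ι R n + ι R m * ι R n ≈⟨ sym (distribʳ _ _ _) ⟩
    (1# + ι R m) * ι R n    ∎

  ∑-applyUpTo-zero : ∀ m (f : ℕ → ℕ) (g : ℕ → Carrier) → (∀ j → g (f j) ≈ 0#) →
                     ∑ (applyUpTo f m) g ≈ 0#
  ∑-applyUpTo-zero zero    f g g≈0 = refl
  ∑-applyUpTo-zero (suc m) f g g≈0 =
    trans (+-cong (g≈0 0) (∑-applyUpTo-zero m (λ j → f (suc j)) g (λ j → g≈0 (suc j)))) (+-identityˡ _)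

  ∑-applyUpTo-indicator : ∀ m (f : ℕ → ℕ) (g : ℕ → Carrier) a t → t < m →
                          (∀ j → g (f j) ≈ χ (does (t ℕ.≟ j)) a) → ∑ (applyUpTo f m) g ≈ a
  ∑-applyUpTo-indicator (suc m) f g a zero    _ g≈ =
    trans (+-cong (g≈ 0) (∑-applyUpTo-zero m (λ j → f (suc j)) g (λ j → g≈ (suc j)))) (+-identityʳ _)
  ∑-applyUpTo-indicator (suc m) f g a (suc t) (s≤s t<m) g≈ =
    trans (+-cong (g≈ 0) (∑-applyUpTo-indicator m (λ j → f (suc j)) g a t t<m (λ j → g≈ (suc j))))
          (+-identityˡ _)

  ∑-range-indicator : ∀ m n x (a : Carrier) → m ≤ x → x ≤ n →
                      ∑ (range m n) (λ i → χ (does (x ℕ.≟ i)) a) ≈ a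
  ∑-range-indicator m n x a m≤x x≤n = begin
    ∑ (range m n) (λ i → χ (does (x ℕ.≟ i)) a)
      ≡⟨ ∑-map (m ℕ.+_) (upTo (suc (n ℕ.∸ m))) _ ⟩
    ∑ (upTo (suc (n ℕ.∸ m))) (λ j → χ (does (x ℕ.≟ m ℕ.+ j)) a)
      ≈⟨ ∑-applyUpTo-indicator (suc (n ℕ.∸ m)) (λ j → j) _ a (x ℕ.∸ m) (s≤s x∸m≤n∸m) shifted ⟩
    a ∎
    where
    m+[x∸m]≡x : m ℕ.+ (x ℕ.∸ m) ≡ x
    m+[x∸m]≡x = ℕP.m+[n∸m]≡n m≤x
    x∸m≤n∸m : x ℕ.∸ m ≤ n ℕ.∸ m
    x∸m≤n∸m = ℕP.∸-monoˡ-≤ m x≤n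
    shifted : ∀ j → χ (does (x ℕ.≟ m ℕ.+ j)) a ≈ χ (does (x ℕ.∸ m ℕ.≟ j)) a
    shifted j = reflexive (≡.cong (λ b → χ b a) (does-⇔ (mk⇔ to from) (x ℕ.≟ m ℕ.+ j) (x ℕ.∸ m ℕ.≟ j)))
      where
      to : x ≡ m ℕ.+ j → x ℕ.∸ m ≡ j
      to x≡ = ℕP.+-cancelˡ-≡ m _ _ (≡.trans m+[x∸m]≡x x≡)
      from : x ℕ.∸ m ≡ j → x ≡ m ℕ.+ j
      from t≡j = ≡.trans (≡.sym m+[x∸m]≡x) (≡.cong (m ℕ.+_) t≡j)

  range-bounds : ∀ m n → m ≤ n → All (λ x → (m ≤ x) × (x ≤ n)) (range m n)
  range-bounds m n m≤n = AllP.map⁺ (AllP.applyUpTo⁺₁ _ (suc (n ℕ.∸ m)) bounds)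
    where
    bounds : ∀ {j} → j < suc (n ℕ.∸ m) → (m ≤ m ℕ.+ j) × (m ℕ.+ j ≤ n)
    bounds {j} (s≤s j≤n∸m) =
      ℕP.m≤m+n m j , ≡.subst (m ℕ.+ j ≤_) (ℕP.m+[n∸m]≡n m≤n) (ℕP.+-monoʳ-≤ m j≤n∸m)

module LinearCombinations {c ℓ : Level} (F : CharZeroField c ℓ) where
  open CharZeroField F hiding (zero)
  open Hopf F
  open FiniteSums commutativeRing public
  open import Relation.Binary.Reasoning.Setoid setoid
  open import Algebra.Properties.CommutativeSemigroup *-commutativeSemigroup
    using () renaming (x∙yz≈y∙xz to *-leftComm)
  open import Algebra.Properties.Ring ring using (-1*x≈-x)
  open import Algebra.Properties.Group +-group using (x∙y⁻¹≈ε⇒x≈y)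

  ⟨_∣_⟩ : {X : Set} → (X → Carrier) → Lin X → Carrier
  ⟨ h ∣ v ⟩ = ∑ v (λ e → proj₁ e * h (proj₂ e))

  module _ {X : Set} where

    pair-++ : (h : X → Carrier) (v w : Lin X) → ⟨ h ∣ v ++ w ⟩ ≈ ⟨ h ∣ v ⟩ + ⟨ h ∣ w ⟩
    pair-++ h v w = ∑-++ v w _

    pair-singleton : (h : X → Carrier) (x : X) → ⟨ h ∣ (1# , x) ∷ [] ⟩ ≈ h x
    pair-singleton h x = trans (+-identityʳ _) (*-identityˡ _)

    pair-unit-coefficients : (h : X → Carrier) (xs : List X) → ⟨ h ∣ map (1# ,_) xs ⟩ ≈ ∑ xs h
    pair-unit-coefficients h xs = trans (reflexive (∑-map (1# ,_) xs _)) (∑-cong xs (λ x → *-identityˡ (h x)))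

    pair-scale : (h : X → Carrier) (a : Carrier) (v : Lin X) → ⟨ h ∣ scale a v ⟩ ≈ a * ⟨ h ∣ v ⟩
    pair-scale h a v = begin
      ⟨ h ∣ scale a v ⟩                       ≡⟨ ∑-map _ v _ ⟩
      ∑ v (λ e → (a * proj₁ e) * h (proj₂ e)) ≈⟨ ∑-cong v (λ e → *-assoc a _ _) ⟩
      ∑ v (λ e → a * (proj₁ e * h (proj₂ e))) ≈⟨ sym (∑-*ˡ v a _) ⟩
      a * ⟨ h ∣ v ⟩                           ∎

    pair-cong : {h g : X → Carrier} (v : Lin X) → (∀ x → h x ≈ g x) → ⟨ h ∣ v ⟩ ≈ ⟨ g ∣ v ⟩
    pair-cong v h≈g = ∑-cong v (λ e → *-congˡ (h≈g (proj₂ e)))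

    pair-congᴬ : {P : X → Set} {h g : X → Carrier} (v : Lin X) →
                 All (λ e → P (proj₂ e)) v → (∀ x → P x → h x ≈ g x) → ⟨ h ∣ v ⟩ ≈ ⟨ g ∣ v ⟩
    pair-congᴬ v pv h≈g = ∑-congᴬ pv (λ e p → *-congˡ (h≈g (proj₂ e) p))

    pair-* : (a : Carrier) (h : X → Carrier) (v : Lin X) → ⟨ (λ x → a * h x) ∣ v ⟩ ≈ a * ⟨ h ∣ v ⟩
    pair-* a h v = trans (∑-cong v (λ e → *-leftComm (proj₁ e) a _)) (sym (∑-*ˡ v a _))

    pair-zero : (v : Lin X) → ⟨ (λ _ → 0#) ∣ v ⟩ ≈ 0#
    pair-zero v = trans (∑-cong v (λ e → zeroʳ (proj₁ e))) (∑-zero v)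

  module _ {a : Level} {A : Set a} {X : Set} where

    pair-concatMap : (g : A → Lin X) (xs : List A) (h : X → Carrier) →
                     ⟨ h ∣ concatMap g xs ⟩ ≈ ∑ xs (λ x → ⟨ h ∣ g x ⟩)
    pair-concatMap g xs h = ∑-concatMap g xs _

    ∑-pair-comm : (xs : List A) (v : Lin X) (g : A → X → Carrier) →
                  ∑ xs (λ p → ⟨ g p ∣ v ⟩) ≈ ⟨ (λ x → ∑ xs (λ p → g p x)) ∣ v ⟩
    ∑-pair-comm xs v g = begin
      ∑ xs (λ p → ∑ v (λ e → proj₁ e * g p (proj₂ e))) ≈⟨ ∑-comm xs v _ ⟩
      ∑ v (λ e → ∑ xs (λ p → proj₁ e * g p (proj₂ e))) ≈⟨ ∑-cong v (λ e → sym (∑-*ˡ xs _ _)) ⟩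
      ⟨ (λ x → ∑ xs (λ p → g p x)) ∣ v ⟩                ∎

  module _ {X Y : Set} where

    pair-linext : (f : X → Lin Y) (v : Lin X) (h : Y → Carrier) →
                  ⟨ h ∣ linext f v ⟩ ≈ ⟨ (λ x → ⟨ h ∣ f x ⟩) ∣ v ⟩
    pair-linext f v h = trans (pair-concatMap _ v h) (∑-cong v (λ e → pair-scale h (proj₁ e) (f (proj₂ e))))

    pair-comm : (v : Lin X) (w : Lin Y) (k : X → Y → Carrier) →
                ⟨ (λ x → ⟨ k x ∣ w ⟩) ∣ v ⟩ ≈ ⟨ (λ y → ⟨ (λ x → k x y) ∣ v ⟩) ∣ w ⟩
    pair-comm v w k = begin
      ∑ v (λ e → proj₁ e * ⟨ k (proj₂ e) ∣ w ⟩)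
        ≈⟨ ∑-cong v (λ e → ∑-*ˡ w _ _) ⟩
      ∑ v (λ e → ∑ w (λ e′ → proj₁ e * (proj₁ e′ * k (proj₂ e) (proj₂ e′))))
        ≈⟨ ∑-comm v w _ ⟩
      ∑ w (λ e′ → ∑ v (λ e → proj₁ e * (proj₁ e′ * k (proj₂ e) (proj₂ e′))))
        ≈⟨ ∑-cong w (λ e′ → ∑-cong v (λ e → *-leftComm _ _ _)) ⟩
      ∑ w (λ e′ → ∑ v (λ e → proj₁ e′ * (proj₁ e * k (proj₂ e) (proj₂ e′))))
        ≈⟨ ∑-cong w (λ e′ → sym (∑-*ˡ v _ _)) ⟩
      ⟨ (λ y → ⟨ (λ x → k x y) ∣ v ⟩) ∣ w ⟩ ∎

  pair-bilin : {X Y Z : Set} (f : X → Y → Lin Z) (v : Lin X) (w : Lin Y) (h : Z → Carrier) →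
               ⟨ h ∣ bilin f v w ⟩ ≈ ⟨ (λ x → ⟨ (λ y → ⟨ h ∣ f x y ⟩) ∣ w ⟩) ∣ v ⟩
  pair-bilin f v w h = trans (pair-concatMap _ v h) (∑-cong v λ e → begin
    ⟨ h ∣ concatMap _ w ⟩
      ≈⟨ pair-concatMap _ w h ⟩
    ∑ w (λ e′ → ⟨ h ∣ scale (proj₁ e * proj₁ e′) (f (proj₂ e) (proj₂ e′)) ⟩)
      ≈⟨ ∑-cong w (λ e′ → trans (pair-scale h _ (f (proj₂ e) (proj₂ e′))) (*-assoc _ _ _)) ⟩
    ∑ w (λ e′ → proj₁ e * (proj₁ e′ * ⟨ h ∣ f (proj₂ e) (proj₂ e′) ⟩))
      ≈⟨ sym (∑-*ˡ w _ _) ⟩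
    proj₁ e * ⟨ (λ y → ⟨ h ∣ f (proj₂ e) y ⟩) ∣ w ⟩ ∎)

  pair-regroup : {A X : Set} (key : A → ℕ) (G : A → Lin X) (xs : List A) (m n : ℕ) (h : X → Carrier) →
                 All (λ a → (m ≤ key a) × (key a ≤ n)) xs →
                 ⟨ h ∣ concatMap (λ i → concatMap G (filter (λ a → key a ℕ.≟ i) xs)) (range m n) ⟩ ≈ ⟨ h ∣ concatMap G xs ⟩
  pair-regroup key G xs m n h bounds = begin
    ⟨ h ∣ concatMap (λ i → concatMap G (filter (λ a → key a ℕ.≟ i) xs)) (range m n) ⟩
      ≈⟨ pair-concatMap (λ i → concatMap G (filter (λ a → key a ℕ.≟ i) xs)) (range m n) h ⟩
    ∑ (range m n) (λ i → ⟨ h ∣ concatMap G (filter (λ a → key a ℕ.≟ i) xs) ⟩)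
      ≈⟨ ∑-cong (range m n) (λ i → trans (pair-concatMap G (filter (λ a → key a ℕ.≟ i) xs) h) (∑-filter (λ a → key a ℕ.≟ i) xs _)) ⟩
    ∑ (range m n) (λ i → ∑ xs (λ a → χ (does (key a ℕ.≟ i)) ⟨ h ∣ G a ⟩))
      ≈⟨ ∑-comm (range m n) xs _ ⟩
    ∑ xs (λ a → ∑ (range m n) (λ i → χ (does (key a ℕ.≟ i)) ⟨ h ∣ G a ⟩))
      ≈⟨ ∑-congᴬ bounds (λ a (m≤ , ≤n) → ∑-range-indicator m n (key a) _ m≤ ≤n) ⟩
    ∑ xs (λ a → ⟨ h ∣ G a ⟩)
      ≈⟨ sym (pair-concatMap G xs h) ⟩
    ⟨ h ∣ concatMap G xs ⟩ ∎

  module Coefficients {X : Set} (_≟_ : DecidableEquality X) where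

    δ : X → X → Carrier
    δ x y = χ (does (y ≟ x)) 1#

    δ-refl : ∀ x → δ x x ≈ 1#
    δ-refl x with x ≟ x
    ... | yes _  = refl
    ... | no x≢x = ⊥-elim (x≢x ≡.refl)

    δ-≢ : ∀ x y → ¬ x ≡ y → δ x y ≈ 0#
    δ-≢ x y x≢y with y ≟ x
    ... | yes ≡.refl = ⊥-elim (x≢y ≡.refl)
    ... | no _       = refl

    δ-sym : ∀ x y → δ x y ≈ δ y x
    δ-sym x y = reflexive (≡.cong (λ b → χ b 1#) (does-⇔ (mk⇔ ≡.sym ≡.sym) (y ≟ x) (x ≟ y)))

    δ-subst : ∀ x y (f : X → Carrier) → δ x y * f y ≈ δ x y * f x
    δ-subst x y f with y ≟ x
    ... | yes ≡.refl = refl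
    ... | no _       = trans (zeroˡ _) (sym (zeroˡ _))

    coeff-pair : ∀ v x → coeff _≟_ v x ≈ ⟨ δ x ∣ v ⟩
    coeff-pair []            x = refl
    coeff-pair ((a , y) ∷ v) x with does (y ≟ x)
    ... | true  = +-cong (sym (*-identityʳ a)) (coeff-pair v x)
    ... | false = trans (coeff-pair v x) (sym (trans (+-congʳ (zeroʳ a)) (+-identityˡ _)))

    infix 4 _≈ᶜ_
    _≈ᶜ_ : Lin X → Lin X → Set ℓ
    v ≈ᶜ w = ∀ x → coeff _≟_ v x ≈ coeff _≟_ w x

    ≈ᶜ-from-pair : ∀ v w → (∀ h → ⟨ h ∣ v ⟩ ≈ ⟨ h ∣ w ⟩) → v ≈ᶜ w
    ≈ᶜ-from-pair v w v≈w x = trans (coeff-pair v x) (trans (v≈w (δ x)) (sym (coeff-pair w x)))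

    without : X → Lin X → Lin X
    without y = filter (λ e → ¬? (proj₂ e ≟ y))

    private
      split-at : ∀ y (h : X → Carrier) (e : Carrier × X) →
        proj₁ e * h (proj₂ e) ≈ (proj₁ e * δ y (proj₂ e)) * h y + χ (does (¬? (proj₂ e ≟ y))) (proj₁ e * h (proj₂ e))
      split-at y h (a , z) with z ≟ y
      ... | yes ≡.refl = trans (sym (+-identityʳ _)) (+-congʳ (*-congʳ (sym (*-identityʳ a))))
      ... | no _       = sym (trans (+-congʳ (trans (*-congʳ (zeroʳ a)) (zeroˡ _))) (+-identityˡ _))

      drop-self : ∀ y (e : Carrier × X) → χ (does (¬? (proj₂ e ≟ y))) (proj₁ e * δ y (proj₂ e)) ≈ 0#
      drop-self y (a , z) with z ≟ y
      ... | yes _ = refl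
      ... | no _  = zeroʳ a

      keep-other : ∀ {x y} → ¬ x ≡ y → (e : Carrier × X) →
                   χ (does (¬? (proj₂ e ≟ y))) (proj₁ e * δ x (proj₂ e)) ≈ proj₁ e * δ x (proj₂ e)
      keep-other {x} {y} x≢y (a , z) with z ≟ y
      ... | yes ≡.refl = sym (trans (*-congˡ (δ-≢ x y x≢y)) (zeroʳ a))
      ... | no _       = refl

    pair-without : ∀ y h v → ⟨ h ∣ v ⟩ ≈ coeff _≟_ v y * h y + ⟨ h ∣ without y v ⟩
    pair-without y h v = begin
      ⟨ h ∣ v ⟩
        ≈⟨ trans (∑-cong v (split-at y h)) (∑-+ v _ _) ⟩
      ∑ v (λ e → (proj₁ e * δ y (proj₂ e)) * h y) + ∑ v (λ e → χ (does (¬? (proj₂ e ≟ y))) (proj₁ e * h (proj₂ e)))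
        ≈⟨ +-cong (sym (∑-*ʳ v (h y) _)) (sym (∑-filter (λ e → ¬? (proj₂ e ≟ y)) v _)) ⟩
      ⟨ δ y ∣ v ⟩ * h y + ⟨ h ∣ without y v ⟩
        ≈⟨ +-congʳ (*-congʳ (sym (coeff-pair v y))) ⟩
      coeff _≟_ v y * h y + ⟨ h ∣ without y v ⟩ ∎

    coeff-without-self : ∀ y v → coeff _≟_ (without y v) y ≈ 0#
    coeff-without-self y v = begin
      coeff _≟_ (without y v) y ≈⟨ coeff-pair (without y v) y ⟩
      ⟨ δ y ∣ without y v ⟩     ≈⟨ ∑-filter (λ e → ¬? (proj₂ e ≟ y)) v _ ⟩
      _                         ≈⟨ trans (∑-cong v (drop-self y)) (∑-zero v) ⟩
      0#                        ∎

    coeff-without-other : ∀ {x y} → ¬ x ≡ y → ∀ v → coeff _≟_ (without y v) x ≈ coeff _≟_ v x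
    coeff-without-other {x} {y} x≢y v = begin
      coeff _≟_ (without y v) x ≈⟨ coeff-pair (without y v) x ⟩
      ⟨ δ x ∣ without y v ⟩     ≈⟨ ∑-filter (λ e → ¬? (proj₂ e ≟ y)) v _ ⟩
      _                         ≈⟨ ∑-cong v (keep-other x≢y) ⟩
      ⟨ δ x ∣ v ⟩               ≈⟨ sym (coeff-pair v x) ⟩
      coeff _≟_ v x             ∎

    pair-of-zero-coefficients : ∀ n v → length v ≤ n → (∀ x → coeff _≟_ v x ≈ 0#) → ∀ h → ⟨ h ∣ v ⟩ ≈ 0#
    pair-of-zero-coefficients _       []            _           _  h = refl
    pair-of-zero-coefficients (suc n) ((a , y) ∷ v) (s≤s len≤n) v≈0 h = begin
      a * h y + ⟨ h ∣ v ⟩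
        ≈⟨ +-congˡ (pair-without y h v) ⟩
      a * h y + (coeff _≟_ v y * h y + ⟨ h ∣ without y v ⟩)
        ≈⟨ trans (sym (+-assoc _ _ _)) (+-congʳ (sym (distribʳ (h y) a _))) ⟩
      (a + coeff _≟_ v y) * h y + ⟨ h ∣ without y v ⟩
        ≈⟨ +-cong (*-congʳ head≈0) (pair-of-zero-coefficients n (without y v) (ℕP.≤-trans (ListP.length-filter _ v) len≤n) rest≈0 h) ⟩
      0# * h y + 0#
        ≈⟨ trans (+-identityʳ _) (zeroˡ _) ⟩
      0# ∎
      where
      coeff-∷ : ∀ x → coeff _≟_ ((a , y) ∷ v) x ≈ a * δ x y + coeff _≟_ v x
      coeff-∷ x = trans (coeff-pair ((a , y) ∷ v) x) (+-congˡ (sym (coeff-pair v x)))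
      head≈0 : a + coeff _≟_ v y ≈ 0#
      head≈0 = trans (+-congʳ (sym (trans (*-congˡ (δ-refl y)) (*-identityʳ a)))) (trans (sym (coeff-∷ y)) (v≈0 y))
      rest≈0 : ∀ x → coeff _≟_ (without y v) x ≈ 0#
      rest≈0 x with x ≟ y
      ... | yes ≡.refl = coeff-without-self y v
      ... | no x≢y     = begin
        coeff _≟_ (without y v) x   ≈⟨ coeff-without-other x≢y v ⟩
        coeff _≟_ v x               ≈⟨ sym (trans (+-congʳ (trans (*-congˡ (δ-≢ x y x≢y)) (zeroʳ a))) (+-identityˡ _)) ⟩
        a * δ x y + coeff _≟_ v x   ≈⟨ sym (coeff-∷ x) ⟩
        coeff _≟_ ((a , y) ∷ v) x   ≈⟨ v≈0 x ⟩
        0#                          ∎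

    pair-resp-≈ᶜ : ∀ h v w → v ≈ᶜ w → ⟨ h ∣ v ⟩ ≈ ⟨ h ∣ w ⟩
    pair-resp-≈ᶜ h v w v≈w = x∙y⁻¹≈ε⇒x≈y _ _ (begin
      ⟨ h ∣ v ⟩ - ⟨ h ∣ w ⟩             ≈⟨ +-congˡ (sym (-1*x≈-x _)) ⟩
      ⟨ h ∣ v ⟩ + - 1# * ⟨ h ∣ w ⟩      ≈⟨ sym (pair-difference h) ⟩
      ⟨ h ∣ v ++ scale (- 1#) w ⟩       ≈⟨ pair-of-zero-coefficients _ (v ++ scale (- 1#) w) ℕP.≤-refl difference≈0 h ⟩
      0#                                ∎)
      where
      pair-difference : ∀ g → ⟨ g ∣ v ++ scale (- 1#) w ⟩ ≈ ⟨ g ∣ v ⟩ + - 1# * ⟨ g ∣ w ⟩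
      pair-difference g = trans (pair-++ g v _) (+-congˡ (pair-scale g (- 1#) w))
      difference≈0 : ∀ x → coeff _≟_ (v ++ scale (- 1#) w) x ≈ 0#
      difference≈0 x = begin
        coeff _≟_ (v ++ scale (- 1#) w) x     ≈⟨ coeff-pair (v ++ scale (- 1#) w) x ⟩
        ⟨ δ x ∣ v ++ scale (- 1#) w ⟩         ≈⟨ pair-difference (δ x) ⟩
        ⟨ δ x ∣ v ⟩ + - 1# * ⟨ δ x ∣ w ⟩      ≈⟨ +-cong (sym (coeff-pair v x)) (-1*x≈-x _) ⟩
        coeff _≟_ v x + - ⟨ δ x ∣ w ⟩         ≈⟨ +-cong (v≈w x) (-‿cong (sym (coeff-pair w x))) ⟩
        coeff _≟_ w x - coeff _≟_ w x         ≈⟨ -‿inverseʳ _ ⟩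
        0#                                    ∎

module Compositions {c ℓ : Level} (F : CharZeroField c ℓ) where
  open CharZeroField F hiding (zero)
  open Hopf F
  open LinearCombinations F
  open Coefficients _≟C_
  open import Relation.Binary.Reasoning.Setoid setoid

  δ⁺ : ℕ⁺ → ℕ⁺ → Carrier
  δ⁺ = Coefficients.δ _≟⁺_

  δ⁺-ℕ : ∀ x y → δ⁺ x y ≈ χ (does (⟦ x ⟧ ℕ.≟ ⟦ y ⟧)) 1#
  δ⁺-ℕ (1+ m) (1+ n) = reflexive (≡.cong (λ b → χ b 1#) (does-⇔ (mk⇔ to from) ((1+ n) ≟⁺ (1+ m)) (suc m ℕ.≟ suc n)))
    where
    to : 1+ n ≡ 1+ m → suc m ≡ suc n
    to ≡.refl = ≡.refl
    from : suc m ≡ suc n → 1+ n ≡ 1+ m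
    from ≡.refl = ≡.refl

  δ-∷ : ∀ z u x w → δ (z ∷ u) (x ∷ w) ≈ δ⁺ z x * δ u w
  δ-∷ z u x w = by-cases (x ≟⁺ z) (w ≟C u)
    where
    by-cases : Dec (x ≡ z) → Dec (w ≡ u) → δ (z ∷ u) (x ∷ w) ≈ δ⁺ z x * δ u w
    by-cases (yes ≡.refl) (yes ≡.refl) =
      trans (δ-refl (z ∷ u)) (sym (trans (*-cong (Coefficients.δ-refl _≟⁺_ z) (δ-refl u)) (*-identityˡ _)))
    by-cases (yes ≡.refl) (no w≢u) =
      trans (δ-≢ (z ∷ u) (x ∷ w) (λ { ≡.refl → w≢u ≡.refl })) (sym (trans (*-congˡ (δ-≢ u w (λ u≡w → w≢u (≡.sym u≡w)))) (zeroʳ _)))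
    by-cases (no x≢z) _ =
      trans (δ-≢ (z ∷ u) (x ∷ w) (λ { ≡.refl → x≢z ≡.refl }))
            (sym (trans (*-congʳ (Coefficients.δ-≢ _≟⁺_ z x (λ z≡x → x≢z (≡.sym z≡x)))) (zeroˡ _)))

  δ-[]-∷ : ∀ x w → δ [] (x ∷ w) ≈ 0#
  δ-[]-∷ x w = δ-≢ [] (x ∷ w) λ ()

  δ-∷-[] : ∀ x w → δ (x ∷ w) [] ≈ 0#
  δ-∷-[] x w = δ-≢ (x ∷ w) [] λ ()

  size-++ : ∀ u w → size (u ++ w) ≡ size u ℕ.+ size w
  size-++ []      w = ≡.refl
  size-++ (x ∷ u) w = ≡.trans (≡.cong (⟦ x ⟧ ℕ.+_) (size-++ u w)) (≡.sym (ℕP.+-assoc ⟦ x ⟧ (size u) (size w)))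

  length≤size : ∀ u → length u ≤ size u
  length≤size []             = z≤n
  length≤size ((1+ p) ∷ u) = s≤s (ℕP.≤-trans (length≤size u) (ℕP.m≤n+m (size u) p))

  private
    incHead : Comp → Comp
    incHead []            = []
    incHead ((1+ p) ∷ ps) = (1+ suc p) ∷ ps

    compsSuc-suc : ∀ m → compsSuc (suc m) ≡ concatMap (λ u → (1+ 0 ∷ u) ∷ incHead u ∷ []) (compsSuc m)
    compsSuc-suc m = ListP.concatMap-cong (λ { [] → ≡.refl ; (x ∷ u) → ≡.refl }) (compsSuc m)

  δ-∷-same : ∀ x u w → δ (x ∷ u) (x ∷ w) ≈ δ u w
  δ-∷-same x u w = trans (δ-∷ x u x w) (trans (*-congʳ (Coefficients.δ-refl _≟⁺_ x)) (*-identityˡ _))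

  δ-∷-≢ : ∀ z x → ¬ z ≡ x → ∀ u w → δ (z ∷ u) (x ∷ w) ≈ 0#
  δ-∷-≢ z x z≢x u w = trans (δ-∷ z u x w) (trans (*-congʳ (Coefficients.δ-≢ _≟⁺_ z x z≢x)) (zeroˡ _))

  δ-incHead : ∀ p q u w → δ ((1+ suc p) ∷ u) ((1+ suc q) ∷ w) ≈ δ ((1+ p) ∷ u) ((1+ q) ∷ w)
  δ-incHead p q u w = begin
    δ ((1+ suc p) ∷ u) ((1+ suc q) ∷ w)   ≈⟨ δ-∷ (1+ suc p) u (1+ suc q) w ⟩
    δ⁺ (1+ suc p) (1+ suc q) * δ u w      ≈⟨ *-congʳ (trans (δ⁺-ℕ (1+ suc p) (1+ suc q)) (sym (δ⁺-ℕ (1+ p) (1+ q)))) ⟩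
    δ⁺ (1+ p) (1+ q) * δ u w              ≈⟨ δ-∷ (1+ p) u (1+ q) w ⟨
    δ ((1+ p) ∷ u) ((1+ q) ∷ w)           ∎

  compsSuc-size : ∀ n → All (λ u → size u ≡ suc n) (compsSuc n)
  compsSuc-size zero    = ≡.refl ∷ []
  compsSuc-size (suc n) rewrite compsSuc-suc n =
    all-concatMap⁺ (λ { {(1+ p) ∷ ps} e → ≡.cong suc e ∷ ≡.cong suc e ∷ [] }) (compsSuc-size n)

  ∑-compsSuc-δ : ∀ m w → ∑ (compsSuc m) (δ w) ≈ χ (does (size w ℕ.≟ suc m)) 1#
  ∑-compsSuc-δ zero []                        = trans (+-identityʳ _) (δ-[]-∷ (1+ 0) [])
  ∑-compsSuc-δ zero ((1+ zero) ∷ [])          = trans (+-identityʳ _) (δ-refl (1+ 0 ∷ []))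
  ∑-compsSuc-δ zero ((1+ zero) ∷ (y ∷ w))     = trans (+-identityʳ _) (trans (δ-∷-same (1+ 0) (y ∷ w) []) (δ-∷-[] y w))
  ∑-compsSuc-δ zero ((1+ suc p) ∷ w)          = trans (+-identityʳ _) (δ-∷-≢ (1+ suc p) (1+ 0) (λ ()) w [])
  ∑-compsSuc-δ (suc m) w rewrite compsSuc-suc m = trans (∑-concatMap _ (compsSuc m) (δ w)) (by-head w)
    where
    by-head : ∀ w → ∑ (compsSuc m) (λ u → ∑ ((1+ 0 ∷ u) ∷ incHead u ∷ []) (δ w)) ≈ χ (does (size w ℕ.≟ suc (suc m))) 1#
    by-head [] = trans (∑-congᴬ (compsSuc-size m) both-zero) (∑-zero (compsSuc m))
      where
      both-zero : ∀ u → size u ≡ suc m → ∑ ((1+ 0 ∷ u) ∷ incHead u ∷ []) (δ []) ≈ 0#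
      both-zero ((1+ q) ∷ ps) _ = trans (+-cong (δ-[]-∷ (1+ 0) ((1+ q) ∷ ps)) (trans (+-identityʳ _) (δ-[]-∷ (1+ suc q) ps))) (+-identityˡ _)
    by-head ((1+ zero) ∷ w′) = trans (∑-cong (compsSuc m) only-first) (∑-compsSuc-δ m w′)
      where
      only-first : ∀ u → ∑ ((1+ 0 ∷ u) ∷ incHead u ∷ []) (δ ((1+ 0) ∷ w′)) ≈ δ w′ u
      only-first []            = trans (+-congˡ (trans (+-identityʳ _) (δ-∷-[] (1+ 0) w′))) (trans (+-identityʳ _) (δ-∷-same (1+ 0) w′ []))
      only-first ((1+ q) ∷ ps) = trans (+-congˡ (trans (+-identityʳ _) (δ-∷-≢ (1+ 0) (1+ suc q) (λ ()) w′ ps)))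
                                       (trans (+-identityʳ _) (δ-∷-same (1+ 0) w′ ((1+ q) ∷ ps)))
    by-head ((1+ suc p) ∷ w′) = trans (∑-cong (compsSuc m) only-second) (∑-compsSuc-δ m ((1+ p) ∷ w′))
      where
      only-second : ∀ u → ∑ ((1+ 0 ∷ u) ∷ incHead u ∷ []) (δ ((1+ suc p) ∷ w′)) ≈ δ ((1+ p) ∷ w′) u
      only-second []            = trans (+-cong (δ-∷-≢ (1+ suc p) (1+ 0) (λ ()) w′ []) (+-identityʳ _))
                                         (trans (+-identityˡ _) (trans (δ-∷-[] (1+ suc p) w′) (sym (δ-∷-[] (1+ p) w′))))
      only-second ((1+ q) ∷ ps) = trans (+-cong (δ-∷-≢ (1+ suc p) (1+ 0) (λ ()) w′ ((1+ q) ∷ ps)) (+-identityʳ _))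
                                         (trans (+-identityˡ _) (δ-incHead p q w′ ps))

  ∑-comps-δ : ∀ n w → ∑ (comps n) (δ w) ≈ χ (does (size w ℕ.≟ n)) 1#
  ∑-comps-δ zero    []      = trans (+-identityʳ _) (δ-refl [])
  ∑-comps-δ zero    (x ∷ w) = trans (+-identityʳ _) (δ-∷-[] x w)
  ∑-comps-δ (suc n) w       = ∑-compsSuc-δ n w

  ∑-comps-δ-subst : ∀ n w (f : Comp → Carrier) → ∑ (comps n) (λ u → δ w u * f u) ≈ χ (does (size w ℕ.≟ n)) (f w)
  ∑-comps-δ-subst n w f = begin
    ∑ (comps n) (λ u → δ w u * f u)    ≈⟨ ∑-cong (comps n) (λ u → δ-subst w u f) ⟩
    ∑ (comps n) (λ u → δ w u * f w)    ≈⟨ sym (∑-*ʳ (comps n) (f w) (δ w)) ⟩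
    ∑ (comps n) (δ w) * f w            ≈⟨ *-congʳ (∑-comps-δ n w) ⟩
    χ (does (size w ℕ.≟ n)) 1# * f w   ≈⟨ χ1-* (does (size w ℕ.≟ n)) (f w) ⟩
    χ (does (size w ℕ.≟ n)) (f w)      ∎

  comps-size : ∀ n → All (λ u → size u ≡ n) (comps n)
  comps-size zero    = ≡.refl ∷ []
  comps-size (suc n) = compsSuc-size n

module ProductForm {c ℓ : Level} (F : CharZeroField c ℓ) where
  open CharZeroField F hiding (zero)
  open Hopf F
  open LinearCombinations F
  open Coefficients _≟C_
  open Compositions F
  open import Relation.Binary.Reasoning.Setoid setoid

  pair-mulW : (h : Comp → Carrier) (v w : ISPW) → ⟨ h ∣ mulW v w ⟩ ≈ ⟨ (λ x → ⟨ (λ y → h (x ++ y)) ∣ w ⟩) ∣ v ⟩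
  pair-mulW h v w = trans (pair-bilin (λ α β → (1# , α ++ β) ∷ []) v w h) (pair-cong v (λ x → pair-cong w (λ y → pair-singleton h (x ++ y))))

  P : ℕ → ISPW
  P k = concatMap (λ s → map (λ u → (invFact s , u)) (compsWithParts k s)) (range 1 k)

  Ψ× : Comp → ISPW
  Ψ× []      = unitW
  Ψ× (x ∷ k) = mulW (P ⟦ x ⟧) (Ψ× k)

  pair-P : (h : Comp → Carrier) (k : ℕ) → ⟨ h ∣ P k ⟩ ≈ ∑ (range 1 k) (λ s → ∑ (compsWithParts k s) (λ u → invFact s * h u))
  pair-P h k = trans (pair-concatMap (λ s → map (λ u → (invFact s , u)) (compsWithParts k s)) (range 1 k) h)
                     (∑-cong (range 1 k) (λ s → reflexive (∑-map (λ u → (invFact s , u)) (compsWithParts k s) (λ e → proj₁ e * h (proj₂ e)))))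

  ι-inv : ∀ m → {{NonZero m}} → ι commutativeRing m * inv m ≈ 1#
  ι-inv (suc m) = proj₂ (inverse (ι commutativeRing (suc m)) (charZero m))

  invFact-1 : invFact 1 ≈ 1#
  invFact-1 = trans (sym (*-identityˡ _)) (trans (*-congʳ (sym (+-identityʳ 1#))) (ι-inv 1))

  P-expand : ∀ k h → ⟨ h ∣ P (suc k) ⟩ ≈ ∑ (comps (suc k)) (λ u → invFact (length u) * h u)
  P-expand k h = begin
    ⟨ h ∣ P (suc k) ⟩
      ≈⟨ pair-P h (suc k) ⟩
    ∑ R (λ s → ∑ (compsWithParts (suc k) s) (λ u → invFact s * h u))
      ≈⟨ ∑-cong R (λ s → ∑-filter (λ u → length u ℕ.≟ s) (comps (suc k)) _) ⟩
    ∑ R (λ s → ∑ (comps (suc k)) (λ u → χ (does (length u ℕ.≟ s)) (invFact s * h u)))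
      ≈⟨ ∑-comm R (comps (suc k)) _ ⟩
    ∑ (comps (suc k)) (λ u → ∑ R (λ s → χ (does (length u ℕ.≟ s)) (invFact s * h u)))
      ≈⟨ ∑-congᴬ (comps-size (suc k)) (λ u size≡ →
           trans (∑-cong R (λ s → χ-subst ℕ._≟_ (length u) s (λ t → invFact t * h u)))
                 (∑-range-indicator 1 (suc k) (length u) _ (1≤length u size≡)
                                    (≡.subst (length u ≤_) size≡ (length≤size u)))) ⟩
    ∑ (comps (suc k)) (λ u → invFact (length u) * h u) ∎
    where
    R : List ℕ
    R = range 1 (suc k)
    1≤length : ∀ u → size u ≡ suc k → 1 ≤ length u
    1≤length (_ ∷ _) _ = s≤s z≤n

  coeff-P : ∀ k w → ⟨ δ w ∣ P (suc k) ⟩ ≈ χ (does (size w ℕ.≟ suc k)) (invFact (length w))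
  coeff-P k w = trans (P-expand k (δ w))
    (trans (∑-cong (comps (suc k)) (λ u → *-comm _ _)) (∑-comps-δ-subst (suc k) w (λ u → invFact (length u))))

  coeff-P-single : ∀ g → ⟨ δ (g ∷ []) ∣ P ⟦ g ⟧ ⟩ ≈ 1#
  coeff-P-single (1+ k) = begin
    ⟨ δ ((1+ k) ∷ []) ∣ P (suc k) ⟩                 ≈⟨ coeff-P k ((1+ k) ∷ []) ⟩
    χ (does (suc k ℕ.+ 0 ℕ.≟ suc k)) (invFact 1)   ≡⟨ ≡.cong (λ b → χ b (invFact 1)) (dec-true (suc k ℕ.+ 0 ℕ.≟ suc k) (ℕP.+-identityʳ _)) ⟩
    invFact 1                                      ≈⟨ invFact-1 ⟩
    1#                                             ∎

  private
    invFacts : List ℕ → Carrier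
    invFacts s = prodK (map invFact s)

    choices : List ℕ → List ℕ → List (List Comp)
    choices ks s = cartesian (zipWith compsWithParts ks s)

    partCounts : List ℕ → List (List ℕ)
    partCounts ks = cartesian (map (λ k → range 1 k) ks)

    summands : List ℕ → List ℕ → ISPW
    summands ks s = map (λ us → (invFacts s , concat us)) (choices ks s)

  -- Ψ*-basis before grouping its summands by i = s₁ + ⋯ + sₙ.
  Ψ*-unsorted : List ℕ → ISPW
  Ψ*-unsorted ks = concatMap (summands ks) (partCounts ks)

  pair-Ψ*-unsorted : (h : Comp → Carrier) (ks : List ℕ) →
    ⟨ h ∣ Ψ*-unsorted ks ⟩ ≈ ∑ (partCounts ks) (λ s → ∑ (choices ks s) (λ us → invFacts s * h (concat us)))
  pair-Ψ*-unsorted h ks =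
    trans (pair-concatMap (summands ks) (partCounts ks) h)
          (∑-cong (partCounts ks) (λ s → reflexive (∑-map (λ us → (invFacts s , concat us)) (choices ks s) (λ e → proj₁ e * h (proj₂ e)))))

  pair-Ψ*-unsorted-∷ : ∀ k ks h → ⟨ h ∣ Ψ*-unsorted (k ∷ ks) ⟩ ≈ ⟨ h ∣ mulW (P k) (Ψ*-unsorted ks) ⟩
  pair-Ψ*-unsorted-∷ k ks h = begin
    ⟨ h ∣ Ψ*-unsorted (k ∷ ks) ⟩
      ≈⟨ pair-concatMap (summands (k ∷ ks)) (concatMap (λ y → map (y ∷_) (partCounts ks)) R) h ⟩
    ∑ (concatMap (λ y → map (y ∷_) (partCounts ks)) R) (λ s → ⟨ h ∣ summands (k ∷ ks) s ⟩)
      ≈⟨ ∑-concatMap (λ y → map (y ∷_) (partCounts ks)) R _ ⟩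
    ∑ R (λ y → ∑ (map (y ∷_) (partCounts ks)) (λ s → ⟨ h ∣ summands (k ∷ ks) s ⟩))
      ≈⟨ ∑-cong R (λ y → reflexive (∑-map (y ∷_) (partCounts ks) _)) ⟩
    ∑ R (λ y → ∑ (partCounts ks) (λ s → ⟨ h ∣ summands (k ∷ ks) (y ∷ s) ⟩))
      ≈⟨ ∑-cong R (λ y → ∑-cong (partCounts ks) (pair-summands-∷ y)) ⟩
    ∑ R (λ y → ∑ (partCounts ks) (λ s → ∑ (CW y) (λ u → ∑ (choices ks s) (λ us → (invFact y * invFacts s) * h (u ++ concat us)))))
      ≈⟨ ∑-cong R (λ y → ∑-comm (partCounts ks) (CW y) _) ⟩
    ∑ R (λ y → ∑ (CW y) (λ u → ∑ (partCounts ks) (λ s → ∑ (choices ks s) (λ us → (invFact y * invFacts s) * h (u ++ concat us)))))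
      ≈⟨ ∑-cong R (λ y → ∑-cong (CW y) (factor-out y)) ⟩
    ∑ R (λ y → ∑ (CW y) (λ u → invFact y * ⟨ (λ w → h (u ++ w)) ∣ Ψ*-unsorted ks ⟩))
      ≈⟨ sym (trans (pair-mulW h (P k) (Ψ*-unsorted ks)) (pair-P _ k)) ⟩
    ⟨ h ∣ mulW (P k) (Ψ*-unsorted ks) ⟩ ∎
    where
    R : List ℕ
    R = range 1 k
    CW : ℕ → List Comp
    CW = compsWithParts k
    pair-summands-∷ : ∀ y s → ⟨ h ∣ summands (k ∷ ks) (y ∷ s) ⟩ ≈
                      ∑ (CW y) (λ u → ∑ (choices ks s) (λ us → (invFact y * invFacts s) * h (u ++ concat us)))
    pair-summands-∷ y s = begin
      ⟨ h ∣ summands (k ∷ ks) (y ∷ s) ⟩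
        ≡⟨ ∑-map (λ us → (invFacts (y ∷ s) , concat us)) (concatMap (λ u → map (u ∷_) (choices ks s)) (CW y)) _ ⟩
      ∑ (concatMap (λ u → map (u ∷_) (choices ks s)) (CW y)) (λ us → (invFact y * invFacts s) * h (concat us))
        ≈⟨ ∑-concatMap _ (CW y) _ ⟩
      ∑ (CW y) (λ u → ∑ (map (u ∷_) (choices ks s)) (λ us → (invFact y * invFacts s) * h (concat us)))
        ≈⟨ ∑-cong (CW y) (λ u → reflexive (∑-map (u ∷_) (choices ks s) _)) ⟩
      ∑ (CW y) (λ u → ∑ (choices ks s) (λ us → (invFact y * invFacts s) * h (u ++ concat us))) ∎
    factor-out : ∀ y u → ∑ (partCounts ks) (λ s → ∑ (choices ks s) (λ us → (invFact y * invFacts s) * h (u ++ concat us)))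
                         ≈ invFact y * ⟨ (λ w → h (u ++ w)) ∣ Ψ*-unsorted ks ⟩
    factor-out y u = begin
      ∑ (partCounts ks) (λ s → ∑ (choices ks s) (λ us → (invFact y * invFacts s) * h (u ++ concat us)))
        ≈⟨ ∑-cong (partCounts ks) (λ s → trans (∑-cong (choices ks s) (λ us → *-assoc _ _ _)) (sym (∑-*ˡ (choices ks s) _ _))) ⟩
      ∑ (partCounts ks) (λ s → invFact y * ∑ (choices ks s) (λ us → invFacts s * h (u ++ concat us)))
        ≈⟨ sym (∑-*ˡ (partCounts ks) _ _) ⟩
      invFact y * ∑ (partCounts ks) (λ s → ∑ (choices ks s) (λ us → invFacts s * h (u ++ concat us)))
        ≈⟨ *-congˡ (sym (pair-Ψ*-unsorted _ ks)) ⟩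
      invFact y * ⟨ (λ w → h (u ++ w)) ∣ Ψ*-unsorted ks ⟩ ∎

  pair-Ψ*-unsorted-Ψ× : ∀ k h → ⟨ h ∣ Ψ*-unsorted (map ⟦_⟧ k) ⟩ ≈ ⟨ h ∣ Ψ× k ⟩
  pair-Ψ*-unsorted-Ψ× []      h = refl
  pair-Ψ*-unsorted-Ψ× (x ∷ k) h = begin
    ⟨ h ∣ Ψ*-unsorted (⟦ x ⟧ ∷ map ⟦_⟧ k) ⟩                ≈⟨ pair-Ψ*-unsorted-∷ ⟦ x ⟧ (map ⟦_⟧ k) h ⟩
    ⟨ h ∣ mulW (P ⟦ x ⟧) (Ψ*-unsorted (map ⟦_⟧ k)) ⟩       ≈⟨ pair-mulW h (P ⟦ x ⟧) (Ψ*-unsorted (map ⟦_⟧ k)) ⟩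
    ⟨ (λ u → ⟨ (λ w → h (u ++ w)) ∣ Ψ*-unsorted (map ⟦_⟧ k) ⟩) ∣ P ⟦ x ⟧ ⟩
      ≈⟨ pair-cong (P ⟦ x ⟧) (λ u → pair-Ψ*-unsorted-Ψ× k (λ w → h (u ++ w))) ⟩
    ⟨ (λ u → ⟨ (λ w → h (u ++ w)) ∣ Ψ× k ⟩) ∣ P ⟦ x ⟧ ⟩   ≈⟨ sym (pair-mulW h (P ⟦ x ⟧) (Ψ× k)) ⟩
    ⟨ h ∣ Ψ× (x ∷ k) ⟩                                     ∎

  partCounts-bounds : ∀ k → All (λ s → (length k ≤ sumℕ s) × (sumℕ s ≤ sumℕ (map ⟦_⟧ k))) (partCounts (map ⟦_⟧ k))
  partCounts-bounds []      = (z≤n , z≤n) ∷ []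
  partCounts-bounds (x ∷ k) = all-concatMap⁺
    (λ (1≤y , y≤x) → AllP.map⁺ (All.map (λ (l , u) → ℕP.+-mono-≤ 1≤y l , ℕP.+-mono-≤ y≤x u) (partCounts-bounds k)))
    (range-bounds 1 ⟦ x ⟧ (s≤s z≤n))

  pair-Ψ*-basis : ∀ k h → ⟨ h ∣ Ψ*-basis k ⟩ ≈ ⟨ h ∣ Ψ× k ⟩
  pair-Ψ*-basis []      h = refl
  pair-Ψ*-basis (x ∷ k) h =
    trans (pair-regroup sumℕ (summands ks) (partCounts ks) (length (x ∷ k)) (sumℕ ks) h (partCounts-bounds (x ∷ k)))
          (pair-Ψ*-unsorted-Ψ× (x ∷ k) h)
    where
    ks : List ℕ
    ks = map ⟦_⟧ (x ∷ k)

  pair-Ψ* : ∀ h v → ⟨ h ∣ Ψ* v ⟩ ≈ ⟨ (λ x → ⟨ h ∣ Ψ× x ⟩) ∣ v ⟩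
  pair-Ψ* h v = trans (pair-linext Ψ*-basis v h) (pair-cong v (λ x → pair-Ψ*-basis x h))

  Ψ*-cong : ∀ v w → v ≋ w → Ψ* v ≋ Ψ* w
  Ψ*-cong v w v≋w = ≈ᶜ-from-pair (Ψ* v) (Ψ* w) λ h →
    trans (pair-Ψ* h v) (trans (pair-resp-≈ᶜ (λ x → ⟨ h ∣ Ψ× x ⟩) v w v≋w) (sym (pair-Ψ* h w)))

  Ψ*-unit : Ψ* unitN ≋ unitW
  Ψ*-unit = ≈ᶜ-from-pair (Ψ* unitN) unitW λ h → trans (pair-Ψ* h unitN) (pair-singleton (λ x → ⟨ h ∣ Ψ× x ⟩) [])

  P-size : ∀ k → All (λ e → size (proj₂ e) ≡ k) (P k)
  P-size k = AllP.concat⁺ (AllP.map⁺ (All.universal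
    (λ s → AllP.map⁺ (AllP.filter⁺ (λ u → length u ℕ.≟ s) (comps-size k))) (range 1 k)))

  pair-δ[]-Ψ× : ∀ x → ⟨ δ [] ∣ Ψ× x ⟩ ≈ δ [] x
  pair-δ[]-Ψ× []      = pair-singleton (δ []) []
  pair-δ[]-Ψ× (g ∷ x) = begin
    ⟨ δ [] ∣ mulW (P ⟦ g ⟧) (Ψ× x) ⟩                          ≈⟨ pair-mulW (δ []) (P ⟦ g ⟧) (Ψ× x) ⟩
    ⟨ (λ u → ⟨ (λ w → δ [] (u ++ w)) ∣ Ψ× x ⟩) ∣ P ⟦ g ⟧ ⟩   ≈⟨ pair-congᴬ (P ⟦ g ⟧) (P-size ⟦ g ⟧) nonempty ⟩
    ⟨ (λ _ → 0#) ∣ P ⟦ g ⟧ ⟩                                 ≈⟨ pair-zero (P ⟦ g ⟧) ⟩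
    0#                                                       ≈⟨ sym (δ-∷-[] g x) ⟩
    δ [] (g ∷ x)                                             ∎
    where
    nonempty : ∀ u → size u ≡ ⟦ g ⟧ → ⟨ (λ w → δ [] (u ++ w)) ∣ Ψ× x ⟩ ≈ 0#
    nonempty (y ∷ u) _ = trans (pair-cong (Ψ× x) (λ w → δ-∷-[] y (u ++ w))) (pair-zero (Ψ× x))

  Ψ*-counit : ∀ v → counitW (Ψ* v) ≈ counitN v
  Ψ*-counit v = begin
    coeff _≟C_ (Ψ* v) []                ≈⟨ coeff-pair (Ψ* v) [] ⟩
    ⟨ δ [] ∣ Ψ* v ⟩                     ≈⟨ pair-Ψ* (δ []) v ⟩
    ⟨ (λ x → ⟨ δ [] ∣ Ψ× x ⟩) ∣ v ⟩     ≈⟨ pair-cong v pair-δ[]-Ψ× ⟩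
    ⟨ δ [] ∣ v ⟩                        ≈⟨ sym (coeff-pair v []) ⟩
    coeff _≟C_ v []                     ∎

  pair-Ψ×-++ : ∀ x y h → ⟨ h ∣ Ψ× (x ++ y) ⟩ ≈ ⟨ (λ a → ⟨ (λ b → h (a ++ b)) ∣ Ψ× y ⟩) ∣ Ψ× x ⟩
  pair-Ψ×-++ []      y h = sym (pair-singleton (λ a → ⟨ (λ b → h (a ++ b)) ∣ Ψ× y ⟩) [])
  pair-Ψ×-++ (g ∷ x) y h = begin
    ⟨ h ∣ mulW (P ⟦ g ⟧) (Ψ× (x ++ y)) ⟩
      ≈⟨ pair-mulW h (P ⟦ g ⟧) (Ψ× (x ++ y)) ⟩
    ⟨ (λ u → ⟨ (λ t → h (u ++ t)) ∣ Ψ× (x ++ y) ⟩) ∣ P ⟦ g ⟧ ⟩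
      ≈⟨ pair-cong (P ⟦ g ⟧) (λ u → pair-Ψ×-++ x y (λ t → h (u ++ t))) ⟩
    ⟨ (λ u → ⟨ (λ a → ⟨ (λ b → h (u ++ (a ++ b))) ∣ Ψ× y ⟩) ∣ Ψ× x ⟩) ∣ P ⟦ g ⟧ ⟩
      ≈⟨ pair-cong (P ⟦ g ⟧) (λ u → pair-cong (Ψ× x) (λ a → pair-cong (Ψ× y) (λ b →
           reflexive (≡.cong h (≡.sym (ListP.++-assoc u a b)))))) ⟩
    ⟨ (λ u → ⟨ (λ a → ⟨ (λ b → h ((u ++ a) ++ b)) ∣ Ψ× y ⟩) ∣ Ψ× x ⟩) ∣ P ⟦ g ⟧ ⟩
      ≈⟨ sym (pair-mulW (λ a → ⟨ (λ b → h (a ++ b)) ∣ Ψ× y ⟩) (P ⟦ g ⟧) (Ψ× x)) ⟩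
    ⟨ (λ a → ⟨ (λ b → h (a ++ b)) ∣ Ψ× y ⟩) ∣ mulW (P ⟦ g ⟧) (Ψ× x) ⟩ ∎

  pair-mulN : ∀ (h : Comp → Carrier) v w → ⟨ h ∣ mulN v w ⟩ ≈ ⟨ (λ x → ⟨ (λ y → h (x ++ y)) ∣ w ⟩) ∣ v ⟩
  pair-mulN = pair-mulW

  Ψ*-mul : ∀ v w → Ψ* (mulN v w) ≋ mulW (Ψ* v) (Ψ* w)
  Ψ*-mul v w = ≈ᶜ-from-pair (Ψ* (mulN v w)) (mulW (Ψ* v) (Ψ* w)) λ h → begin
    ⟨ h ∣ Ψ* (mulN v w) ⟩
      ≈⟨ pair-Ψ* h (mulN v w) ⟩
    ⟨ (λ z → ⟨ h ∣ Ψ× z ⟩) ∣ mulN v w ⟩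
      ≈⟨ pair-mulN _ v w ⟩
    ⟨ (λ x → ⟨ (λ y → ⟨ h ∣ Ψ× (x ++ y) ⟩) ∣ w ⟩) ∣ v ⟩
      ≈⟨ pair-cong v (λ x → pair-cong w (λ y → pair-Ψ×-++ x y h)) ⟩
    ⟨ (λ x → ⟨ (λ y → ⟨ (λ a → ⟨ (λ b → h (a ++ b)) ∣ Ψ× y ⟩) ∣ Ψ× x ⟩) ∣ w ⟩) ∣ v ⟩
      ≈⟨ pair-cong v (λ x → sym (pair-comm (Ψ× x) w _)) ⟩
    ⟨ (λ x → ⟨ (λ a → ⟨ (λ y → ⟨ (λ b → h (a ++ b)) ∣ Ψ× y ⟩) ∣ w ⟩) ∣ Ψ× x ⟩) ∣ v ⟩
      ≈⟨ pair-cong v (λ x → pair-cong (Ψ× x) (λ a → sym (pair-Ψ* (λ b → h (a ++ b)) w))) ⟩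
    ⟨ (λ x → ⟨ (λ a → ⟨ (λ b → h (a ++ b)) ∣ Ψ* w ⟩) ∣ Ψ× x ⟩) ∣ v ⟩
      ≈⟨ sym (pair-Ψ* _ v) ⟩
    ⟨ (λ a → ⟨ (λ b → h (a ++ b)) ∣ Ψ* w ⟩) ∣ Ψ* v ⟩
      ≈⟨ sym (pair-mulW h (Ψ* v) (Ψ* w)) ⟩
    ⟨ h ∣ mulW (Ψ* v) (Ψ* w) ⟩ ∎

module Triangularity {c ℓ : Level} (F : CharZeroField c ℓ) where
  open CharZeroField F hiding (zero)
  open Hopf F
  open LinearCombinations F
  open Coefficients _≟C_
  open Compositions F
  open ProductForm F
  open import Relation.Binary.Reasoning.Setoid setoid
  open import Algebra.Properties.Ring ring using (-1*x≈-x)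
  open import Algebra.Properties.Group +-group using (//-rightDividesˡ; //-rightDividesʳ)

  record Refines (β α : Comp) : Set where
    field
      size-≡     : size β ≡ size α
      length-≤   : length α ≤ length β
      length-≡⇒≡ : length β ≡ length α → β ≡ α

  private
    tight-sum : ∀ a b c → 1 ≤ a → c ≤ b → a ℕ.+ b ≡ suc c → (a ≡ 1) × (b ≡ c)
    tight-sum (suc zero)    b c _ _   a+b≡ = ≡.refl , ℕP.suc-injective a+b≡
    tight-sum (suc (suc a)) b c _ c≤b a+b≡ =
      ⊥-elim (ℕP.≤⇒≯ c≤b (≡.subst (b <_) (ℕP.suc-injective a+b≡) (s≤s (ℕP.m≤n+m b a))))

  Refines-single : ∀ g u → size u ≡ ⟦ g ⟧ → Refines u (g ∷ [])
  Refines-single (1+ k) (x ∷ u) size≡ = record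
    { size-≡ = ≡.trans size≡ (≡.sym (ℕP.+-identityʳ (suc k))) ; length-≤ = s≤s z≤n ; length-≡⇒≡ = singleton u size≡ }
    where
    singleton : ∀ u → size (x ∷ u) ≡ suc k → length (x ∷ u) ≡ 1 → x ∷ u ≡ (1+ k) ∷ []
    singleton [] size≡ _ = ≡.cong (λ n → (1+ n) ∷ []) (ℕP.suc-injective (≡.trans (≡.sym (ℕP.+-identityʳ ⟦ x ⟧)) size≡))

  Refines-++ : ∀ {g α u w} → Refines u (g ∷ []) → Refines w α → Refines (u ++ w) (g ∷ α)
  Refines-++ {g} {α} {u} {w} u⊑g w⊑α = record
    { size-≡     = ≡.trans (size-++ u w) (≡.cong₂ ℕ._+_ (≡.trans (size-≡ u⊑g) (ℕP.+-identityʳ ⟦ g ⟧)) (size-≡ w⊑α))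
    ; length-≤   = ≡.subst (suc (length α) ≤_) (≡.sym (ListP.length-++ u)) (ℕP.+-mono-≤ (length-≤ u⊑g) (length-≤ w⊑α))
    ; length-≡⇒≡ = λ len≡ →
        let (u-single , w-tight) = tight-sum (length u) (length w) (length α) (length-≤ u⊑g) (length-≤ w⊑α)
                                             (≡.trans (≡.sym (ListP.length-++ u)) len≡)
        in ≡.cong₂ _++_ (length-≡⇒≡ u⊑g u-single) (length-≡⇒≡ w⊑α w-tight)
    }
    where open Refines

  Ψ×-refines : ∀ α → All (λ e → Refines (proj₂ e) α) (Ψ× α)
  Ψ×-refines []      = record { size-≡ = ≡.refl ; length-≤ = z≤n ; length-≡⇒≡ = λ _ → ≡.refl } ∷ []
  Ψ×-refines (g ∷ α) =
    all-concatMap⁺ (λ {(_ , u)} size≡ → all-concatMap⁺ (λ w⊑α → Refines-++ (Refines-single g u size≡) w⊑α ∷ []) (Ψ×-refines α))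
                   (P-size ⟦ g ⟧)

  δ-++-split : ∀ g α u → size u ≡ ⟦ g ⟧ → ∀ w → Refines w α → δ (g ∷ α) (u ++ w) ≈ δ (g ∷ []) u * δ α w
  δ-++-split g α (x ∷ []) _ w _ = begin
    δ (g ∷ α) (x ∷ w)       ≈⟨ δ-∷ g α x w ⟩
    δ⁺ g x * δ α w          ≈⟨ *-congʳ (sym (trans (δ-∷ g [] x []) (trans (*-congˡ (δ-refl [])) (*-identityʳ _)))) ⟩
    δ (g ∷ []) (x ∷ []) * δ α w ∎
  δ-++-split g α (x ∷ y ∷ u) _ w w⊑α =
    trans (δ-≢ (g ∷ α) (x ∷ y ∷ u ++ w) too-long)
          (sym (trans (*-congʳ (trans (δ-∷ g [] x (y ∷ u)) (*-congˡ (δ-[]-∷ y u)))) (trans (*-congʳ (zeroʳ _)) (zeroˡ _))))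
    where
    too-long : ¬ g ∷ α ≡ x ∷ y ∷ u ++ w
    too-long eq = ℕP.≤⇒≯ (Refines.length-≤ w⊑α)
      (≡.subst (λ n → length w < n) (≡.sym (≡.cong (ℕ.pred ∘′ length) eq))
        (s≤s (≡.subst (length w ≤_) (≡.sym (ListP.length-++ u)) (ℕP.m≤n+m (length w) (length u)))))

  coeff-Ψ×-diag : ∀ α → ⟨ δ α ∣ Ψ× α ⟩ ≈ 1#
  coeff-Ψ×-diag []      = trans (pair-singleton (δ []) []) (δ-refl [])
  coeff-Ψ×-diag (g ∷ α) = begin
    ⟨ δ (g ∷ α) ∣ mulW (P ⟦ g ⟧) (Ψ× α) ⟩
      ≈⟨ pair-mulW (δ (g ∷ α)) (P ⟦ g ⟧) (Ψ× α) ⟩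
    ⟨ (λ u → ⟨ (λ w → δ (g ∷ α) (u ++ w)) ∣ Ψ× α ⟩) ∣ P ⟦ g ⟧ ⟩
      ≈⟨ pair-congᴬ (P ⟦ g ⟧) (P-size ⟦ g ⟧) (λ u size≡ → begin
           ⟨ (λ w → δ (g ∷ α) (u ++ w)) ∣ Ψ× α ⟩
             ≈⟨ pair-congᴬ (Ψ× α) (Ψ×-refines α) (δ-++-split g α u size≡) ⟩
           ⟨ (λ w → δ (g ∷ []) u * δ α w) ∣ Ψ× α ⟩
             ≈⟨ pair-* (δ (g ∷ []) u) (δ α) (Ψ× α) ⟩
           δ (g ∷ []) u * ⟨ δ α ∣ Ψ× α ⟩
             ≈⟨ trans (*-congˡ (coeff-Ψ×-diag α)) (*-identityʳ _) ⟩
           δ (g ∷ []) u ∎) ⟩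
    ⟨ δ (g ∷ []) ∣ P ⟦ g ⟧ ⟩
      ≈⟨ coeff-P-single g ⟩
    1# ∎

  defect : Comp → ℕ
  defect β = size β ∸ length β

  defect-< : ∀ {α β} → Refines β α → ¬ β ≡ α → defect β < defect α
  defect-< {α} {β} β⊑α β≢α =
    ≡.subst (λ n → n ∸ length β < defect α) (≡.sym (size-≡ β⊑α))
      (ℕP.∸-monoʳ-< (ℕP.≤∧≢⇒< (length-≤ β⊑α) (λ len≡ → β≢α (length-≡⇒≡ β⊑α (≡.sym len≡))))
                    (≡.subst (length β ≤_) (size-≡ β⊑α) (length≤size β)))
    where open Refines

  lowerTerms : Comp → ISPW
  lowerTerms α = without α (Ψ× α)

  lowerTerms-defect : ∀ α → All (λ e → defect (proj₂ e) < defect α) (lowerTerms α)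
  lowerTerms-defect α = All.map (λ (β⊑α , β≢α) → defect-< β⊑α β≢α)
    (All.zip (AllP.filter⁺ ≢α? (Ψ×-refines α) , AllP.all-filter ≢α? (Ψ× α)))
    where
    ≢α? : (e : Carrier × Comp) → Dec (¬ proj₂ e ≡ α)
    ≢α? e = ¬? (proj₂ e ≟C α)

  pair-Ψ× : ∀ α h → ⟨ h ∣ Ψ× α ⟩ ≈ h α + ⟨ h ∣ lowerTerms α ⟩
  pair-Ψ× α h = begin
    ⟨ h ∣ Ψ× α ⟩                                         ≈⟨ pair-without α h (Ψ× α) ⟩
    coeff _≟C_ (Ψ× α) α * h α + ⟨ h ∣ lowerTerms α ⟩     ≈⟨ +-congʳ (*-congʳ (trans (coeff-pair (Ψ× α) α) (coeff-Ψ×-diag α))) ⟩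
    1# * h α + ⟨ h ∣ lowerTerms α ⟩                      ≈⟨ +-congʳ (*-identityˡ (h α)) ⟩
    h α + ⟨ h ∣ lowerTerms α ⟩                           ∎

  -- The first argument is fuel: any value above the defect of the composition will do.
  Ψ⁻¹-basis : ℕ → Comp → NSym
  Ψ⁻¹-basis zero    α = []
  Ψ⁻¹-basis (suc f) α = (1# , α) ∷ linext (Ψ⁻¹-basis f) (scale (- 1#) (lowerTerms α))

  Ψ⁻¹ : ISPW → NSym
  Ψ⁻¹ = linext (λ β → Ψ⁻¹-basis (suc (defect β)) β)

  pair-Ψ⁻¹-basis : ∀ f α h → ⟨ h ∣ Ψ⁻¹-basis (suc f) α ⟩ ≈ h α - ⟨ (λ β → ⟨ h ∣ Ψ⁻¹-basis f β ⟩) ∣ lowerTerms α ⟩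
  pair-Ψ⁻¹-basis f α h = +-cong (*-identityˡ (h α)) (begin
    ⟨ h ∣ linext (Ψ⁻¹-basis f) (scale (- 1#) (lowerTerms α)) ⟩
      ≈⟨ pair-linext (Ψ⁻¹-basis f) (scale (- 1#) (lowerTerms α)) h ⟩
    ⟨ (λ β → ⟨ h ∣ Ψ⁻¹-basis f β ⟩) ∣ scale (- 1#) (lowerTerms α) ⟩
      ≈⟨ pair-scale _ (- 1#) (lowerTerms α) ⟩
    - 1# * ⟨ (λ β → ⟨ h ∣ Ψ⁻¹-basis f β ⟩) ∣ lowerTerms α ⟩
      ≈⟨ -1*x≈-x _ ⟩
    - ⟨ (λ β → ⟨ h ∣ Ψ⁻¹-basis f β ⟩) ∣ lowerTerms α ⟩ ∎)

  Ψ×-Ψ⁻¹-basis : ∀ f α → defect α < f → ∀ h → ⟨ (λ x → ⟨ h ∣ Ψ× x ⟩) ∣ Ψ⁻¹-basis f α ⟩ ≈ h α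
  Ψ×-Ψ⁻¹-basis (suc f) α (s≤s defect≤f) h = begin
    ⟨ (λ x → ⟨ h ∣ Ψ× x ⟩) ∣ Ψ⁻¹-basis (suc f) α ⟩
      ≈⟨ pair-Ψ⁻¹-basis f α _ ⟩
    ⟨ h ∣ Ψ× α ⟩ - ⟨ (λ β → ⟨ (λ x → ⟨ h ∣ Ψ× x ⟩) ∣ Ψ⁻¹-basis f β ⟩) ∣ lowerTerms α ⟩
      ≈⟨ +-cong (pair-Ψ× α h) (-‿cong (pair-congᴬ (lowerTerms α) (lowerTerms-defect α)
           (λ β β<α → Ψ×-Ψ⁻¹-basis f β (ℕP.<-≤-trans β<α defect≤f) h))) ⟩
    (h α + ⟨ h ∣ lowerTerms α ⟩) - ⟨ h ∣ lowerTerms α ⟩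
      ≈⟨ //-rightDividesʳ _ (h α) ⟩
    h α ∎

  Ψ⁻¹-basis-fuel : ∀ f g α → defect α < f → defect α < g → ∀ h → ⟨ h ∣ Ψ⁻¹-basis f α ⟩ ≈ ⟨ h ∣ Ψ⁻¹-basis g α ⟩
  Ψ⁻¹-basis-fuel (suc f) (suc g) α (s≤s defect≤f) (s≤s defect≤g) h = begin
    ⟨ h ∣ Ψ⁻¹-basis (suc f) α ⟩
      ≈⟨ pair-Ψ⁻¹-basis f α h ⟩
    h α - ⟨ (λ β → ⟨ h ∣ Ψ⁻¹-basis f β ⟩) ∣ lowerTerms α ⟩
      ≈⟨ +-congˡ (-‿cong (pair-congᴬ (lowerTerms α) (lowerTerms-defect α) (λ β β<α →
           Ψ⁻¹-basis-fuel f g β (ℕP.<-≤-trans β<α defect≤f) (ℕP.<-≤-trans β<α defect≤g) h))) ⟩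
    h α - ⟨ (λ β → ⟨ h ∣ Ψ⁻¹-basis g β ⟩) ∣ lowerTerms α ⟩
      ≈⟨ sym (pair-Ψ⁻¹-basis g α h) ⟩
    ⟨ h ∣ Ψ⁻¹-basis (suc g) α ⟩ ∎

  Ψ⁻¹-Ψ× : ∀ α h → ⟨ (λ β → ⟨ h ∣ Ψ⁻¹-basis (suc (defect β)) β ⟩) ∣ Ψ× α ⟩ ≈ h α
  Ψ⁻¹-Ψ× α h = begin
    ⟨ k ∣ Ψ× α ⟩
      ≈⟨ pair-Ψ× α k ⟩
    k α + ⟨ k ∣ lowerTerms α ⟩
      ≈⟨ +-cong (pair-Ψ⁻¹-basis (defect α) α h) (pair-congᴬ (lowerTerms α) (lowerTerms-defect α)
           (λ β β<α → Ψ⁻¹-basis-fuel (suc (defect β)) (defect α) β ℕP.≤-refl β<α h)) ⟩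
    (h α - ⟨ k′ ∣ lowerTerms α ⟩) + ⟨ k′ ∣ lowerTerms α ⟩
      ≈⟨ //-rightDividesˡ _ (h α) ⟩
    h α ∎
    where
    k k′ : Comp → Carrier
    k β = ⟨ h ∣ Ψ⁻¹-basis (suc (defect β)) β ⟩
    k′ β = ⟨ h ∣ Ψ⁻¹-basis (defect α) β ⟩

  Ψ*-injective : ∀ v w → Ψ* v ≋ Ψ* w → v ≋ w
  Ψ*-injective v w Ψ*v≋Ψ*w = ≈ᶜ-from-pair v w λ h → let k = λ β → ⟨ h ∣ Ψ⁻¹-basis (suc (defect β)) β ⟩ in begin
    ⟨ h ∣ v ⟩                        ≈⟨ pair-cong v (λ α → sym (Ψ⁻¹-Ψ× α h)) ⟩
    ⟨ (λ α → ⟨ k ∣ Ψ× α ⟩) ∣ v ⟩     ≈⟨ sym (pair-Ψ* k v) ⟩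
    ⟨ k ∣ Ψ* v ⟩                     ≈⟨ pair-resp-≈ᶜ k (Ψ* v) (Ψ* w) Ψ*v≋Ψ*w ⟩
    ⟨ k ∣ Ψ* w ⟩                     ≈⟨ pair-Ψ* k w ⟩
    ⟨ (λ α → ⟨ k ∣ Ψ× α ⟩) ∣ w ⟩     ≈⟨ pair-cong w (λ α → Ψ⁻¹-Ψ× α h) ⟩
    ⟨ h ∣ w ⟩                        ∎

  Ψ*-Ψ⁻¹ : ∀ w → Ψ* (Ψ⁻¹ w) ≋ w
  Ψ*-Ψ⁻¹ w = ≈ᶜ-from-pair (Ψ* (Ψ⁻¹ w)) w λ h → begin
    ⟨ h ∣ Ψ* (Ψ⁻¹ w) ⟩
      ≈⟨ pair-Ψ* h (Ψ⁻¹ w) ⟩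
    ⟨ (λ x → ⟨ h ∣ Ψ× x ⟩) ∣ Ψ⁻¹ w ⟩
      ≈⟨ pair-linext (λ β → Ψ⁻¹-basis (suc (defect β)) β) w _ ⟩
    ⟨ (λ β → ⟨ (λ x → ⟨ h ∣ Ψ× x ⟩) ∣ Ψ⁻¹-basis (suc (defect β)) β ⟩) ∣ w ⟩
      ≈⟨ pair-cong w (λ β → Ψ×-Ψ⁻¹-basis (suc (defect β)) β ℕP.≤-refl h) ⟩
    ⟨ h ∣ w ⟩ ∎

module Coproduct {c ℓ : Level} (F : CharZeroField c ℓ) where
  open CharZeroField F hiding (zero)
  open Hopf F
  open LinearCombinations F
  open Coefficients _≟C_
  open Compositions F
  open ProductForm F
  open import Relation.Binary.Reasoning.Setoid setoid
  open import Algebra.Properties.CommutativeSemigroup *-commutativeSemigroup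
    using () renaming (x∙yz≈y∙xz to *-leftComm; interchange to *-interchange)

  δ² : Comp × Comp → Comp × Comp → Carrier
  δ² = Coefficients.δ _≟C²_

  δ²-split : ∀ a b x y → δ² (a , b) (x , y) ≈ δ a x * δ b y
  δ²-split a b x y = by-cases (x ≟C a) (y ≟C b)
    where
    by-cases : Dec (x ≡ a) → Dec (y ≡ b) → δ² (a , b) (x , y) ≈ δ a x * δ b y
    by-cases (yes ≡.refl) (yes ≡.refl) =
      trans (Coefficients.δ-refl _≟C²_ (a , b)) (sym (trans (*-cong (δ-refl a) (δ-refl b)) (*-identityˡ _)))
    by-cases (yes ≡.refl) (no y≢b) =
      trans (Coefficients.δ-≢ _≟C²_ (a , b) (x , y) (λ { ≡.refl → y≢b ≡.refl }))
            (sym (trans (*-congˡ (δ-≢ b y (λ b≡y → y≢b (≡.sym b≡y)))) (zeroʳ _)))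
    by-cases (no x≢a) _ =
      trans (Coefficients.δ-≢ _≟C²_ (a , b) (x , y) (λ { ≡.refl → x≢a ≡.refl }))
            (sym (trans (*-congʳ (δ-≢ a x (λ a≡x → x≢a (≡.sym a≡x)))) (zeroˡ _)))

  δ⁺-sym : ∀ x y → δ⁺ x y ≈ δ⁺ y x
  δ⁺-sym = Coefficients.δ-sym _≟⁺_

  ∑-map-∷-δ : ∀ z u x ws → ∑ (map (x ∷_) ws) (δ (z ∷ u)) ≈ δ⁺ z x * ∑ ws (δ u)
  ∑-map-∷-δ z u x ws = trans (reflexive (∑-map (x ∷_) ws (δ (z ∷ u))))
                             (trans (∑-cong ws (δ-∷ z u x)) (sym (∑-*ˡ ws _ _)))

  ∑-map-∷-δ[] : ∀ x ws → ∑ (map (x ∷_) ws) (δ []) ≈ 0#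
  ∑-map-∷-δ[] x ws = trans (reflexive (∑-map (x ∷_) ws (δ []))) (trans (∑-cong ws (δ-[]-∷ x)) (∑-zero ws))

  splitWeight : Comp → Comp → Comp × Comp → Carrier
  splitWeight a b p = δ a (proj₁ p) * δ b (proj₂ p)

  private
    weight-∷ˡ : ∀ x a b z l r → splitWeight (x ∷ a) b (z ∷ l , r) ≈ δ⁺ z x * splitWeight a b (l , r)
    weight-∷ˡ x a b z l r = trans (*-congʳ (trans (δ-∷ x a z l) (*-congʳ (δ⁺-sym x z)))) (*-assoc _ _ _)

    weight-∷ʳ : ∀ a y b z l r → splitWeight a (y ∷ b) (l , z ∷ r) ≈ δ⁺ z y * splitWeight a b (l , r)
    weight-∷ʳ a y b z l r = trans (*-congˡ (trans (δ-∷ y b z r) (*-congʳ (δ⁺-sym y z)))) (*-leftComm _ _ _)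

    weight-[]ˡ : ∀ b z l r → splitWeight [] b (z ∷ l , r) ≈ 0#
    weight-[]ˡ b z l r = trans (*-congʳ (δ-[]-∷ z l)) (zeroˡ _)

    weight-[]ʳ : ∀ a z l r → splitWeight a [] (l , z ∷ r) ≈ 0#
    weight-[]ʳ a z l r = trans (*-congˡ (δ-[]-∷ z r)) (zeroʳ _)

  splits-shuffles-step : ∀ z u → (∀ a b → ∑ (splits u) (splitWeight a b) ≈ ∑ (shuffles a b) (δ u)) → ∀ a b →
    ∑ (splits u) (λ p → splitWeight a b (z ∷ proj₁ p , proj₂ p) + (splitWeight a b (proj₁ p , z ∷ proj₂ p) + 0#))
      ≈ ∑ (shuffles a b) (δ (z ∷ u))
  splits-shuffles-step z u IH [] [] = begin
    ∑ (splits u) (λ p → splitWeight [] [] (z ∷ proj₁ p , proj₂ p) + (splitWeight [] [] (proj₁ p , z ∷ proj₂ p) + 0#))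
      ≈⟨ ∑-cong (splits u) (λ (l , r) → trans (+-cong (weight-[]ˡ [] z l r) (trans (+-identityʳ _) (weight-[]ʳ [] z l r))) (+-identityʳ _)) ⟩
    ∑ (splits u) (λ _ → 0#)
      ≈⟨ ∑-zero (splits u) ⟩
    0#
      ≈⟨ sym (trans (+-identityʳ _) (δ-∷-[] z u)) ⟩
    ∑ (shuffles [] []) (δ (z ∷ u)) ∎
  splits-shuffles-step z u IH [] (y ∷ b) = begin
    ∑ (splits u) (λ p → splitWeight [] (y ∷ b) (z ∷ proj₁ p , proj₂ p) + (splitWeight [] (y ∷ b) (proj₁ p , z ∷ proj₂ p) + 0#))
      ≈⟨ ∑-cong (splits u) (λ (l , r) → trans (+-cong (weight-[]ˡ (y ∷ b) z l r) (+-identityʳ _))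
                                              (trans (+-identityˡ _) (weight-∷ʳ [] y b z l r))) ⟩
    ∑ (splits u) (λ p → δ⁺ z y * splitWeight [] b p)
      ≈⟨ sym (∑-*ˡ (splits u) _ _) ⟩
    δ⁺ z y * ∑ (splits u) (splitWeight [] b)
      ≈⟨ *-congˡ (trans (IH [] b) (+-identityʳ _)) ⟩
    δ⁺ z y * δ u b
      ≈⟨ sym (trans (+-identityʳ _) (δ-∷ z u y b)) ⟩
    ∑ (shuffles [] (y ∷ b)) (δ (z ∷ u)) ∎
  splits-shuffles-step z u IH (x ∷ a) [] = begin
    ∑ (splits u) (λ p → splitWeight (x ∷ a) [] (z ∷ proj₁ p , proj₂ p) + (splitWeight (x ∷ a) [] (proj₁ p , z ∷ proj₂ p) + 0#))
      ≈⟨ ∑-cong (splits u) (λ (l , r) → trans (+-congˡ (trans (+-identityʳ _) (weight-[]ʳ (x ∷ a) z l r)))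
                                              (trans (+-identityʳ _) (weight-∷ˡ x a [] z l r))) ⟩
    ∑ (splits u) (λ p → δ⁺ z x * splitWeight a [] p)
      ≈⟨ sym (∑-*ˡ (splits u) _ _) ⟩
    δ⁺ z x * ∑ (splits u) (splitWeight a [])
      ≈⟨ *-congˡ (trans (IH a []) (trans (reflexive (≡.cong (λ ws → ∑ ws (δ u)) (shuffles-[]ʳ a))) (+-identityʳ _))) ⟩
    δ⁺ z x * δ u a
      ≈⟨ sym (trans (+-identityʳ _) (δ-∷ z u x a)) ⟩
    ∑ (shuffles (x ∷ a) []) (δ (z ∷ u)) ∎
  splits-shuffles-step z u IH (x ∷ a) (y ∷ b) = begin
    ∑ (splits u) (λ p → splitWeight (x ∷ a) (y ∷ b) (z ∷ proj₁ p , proj₂ p) + (splitWeight (x ∷ a) (y ∷ b) (proj₁ p , z ∷ proj₂ p) + 0#))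
      ≈⟨ ∑-cong (splits u) (λ (l , r) → +-cong (weight-∷ˡ x a (y ∷ b) z l r) (trans (+-identityʳ _) (weight-∷ʳ (x ∷ a) y b z l r))) ⟩
    ∑ (splits u) (λ p → δ⁺ z x * splitWeight a (y ∷ b) p + δ⁺ z y * splitWeight (x ∷ a) b p)
      ≈⟨ trans (∑-+ (splits u) _ _) (+-cong (sym (∑-*ˡ (splits u) _ _)) (sym (∑-*ˡ (splits u) _ _))) ⟩
    δ⁺ z x * ∑ (splits u) (splitWeight a (y ∷ b)) + δ⁺ z y * ∑ (splits u) (splitWeight (x ∷ a) b)
      ≈⟨ +-cong (*-congˡ (IH a (y ∷ b))) (*-congˡ (IH (x ∷ a) b)) ⟩
    δ⁺ z x * ∑ (shuffles a (y ∷ b)) (δ u) + δ⁺ z y * ∑ (shuffles (x ∷ a) b) (δ u)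
      ≈⟨ sym (+-cong (∑-map-∷-δ z u x (shuffles a (y ∷ b))) (∑-map-∷-δ z u y (shuffles (x ∷ a) b))) ⟩
    ∑ (map (x ∷_) (shuffles a (y ∷ b))) (δ (z ∷ u)) + ∑ (map (y ∷_) (shuffles (x ∷ a) b)) (δ (z ∷ u))
      ≈⟨ sym (∑-++ (map (x ∷_) (shuffles a (y ∷ b))) _ _) ⟩
    ∑ (shuffles (x ∷ a) (y ∷ b)) (δ (z ∷ u)) ∎

  splits-shuffles : ∀ u a b → ∑ (splits u) (splitWeight a b) ≈ ∑ (shuffles a b) (δ u)
  splits-shuffles [] [] [] =
    +-congʳ (trans (*-cong (δ-refl []) (δ-refl [])) (trans (*-identityˡ _) (sym (δ-refl []))))
  splits-shuffles [] [] (y ∷ b) =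
    +-congʳ (trans (*-congˡ (δ-∷-[] y b)) (trans (zeroʳ _) (sym (δ-[]-∷ y b))))
  splits-shuffles [] (x ∷ a) [] =
    +-congʳ (trans (*-congʳ (δ-∷-[] x a)) (trans (zeroˡ _) (sym (δ-[]-∷ x a))))
  splits-shuffles [] (x ∷ a) (y ∷ b) = begin
    δ (x ∷ a) [] * δ (y ∷ b) [] + 0#
      ≈⟨ trans (+-identityʳ _) (trans (*-congʳ (δ-∷-[] x a)) (zeroˡ _)) ⟩
    0#
      ≈⟨ sym (trans (+-cong (∑-map-∷-δ[] x (shuffles a (y ∷ b))) (∑-map-∷-δ[] y (shuffles (x ∷ a) b))) (+-identityˡ _)) ⟩
    ∑ (map (x ∷_) (shuffles a (y ∷ b))) (δ []) + ∑ (map (y ∷_) (shuffles (x ∷ a) b)) (δ [])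
      ≈⟨ sym (∑-++ (map (x ∷_) (shuffles a (y ∷ b))) _ _) ⟩
    ∑ (shuffles (x ∷ a) (y ∷ b)) (δ []) ∎
  splits-shuffles (z ∷ u) a b =
    trans (∑-concatMap _ (splits u) _) (splits-shuffles-step z u (splits-shuffles u) a b)

  shuffles-size-length : ∀ a b → All (λ w → (size w ≡ size a ℕ.+ size b) × (length w ≡ length a ℕ.+ length b)) (shuffles a b)
  shuffles-size-length []      b       = (≡.refl , ≡.refl) ∷ []
  shuffles-size-length (x ∷ a) []      = (≡.sym (ℕP.+-identityʳ _) , ≡.sym (ℕP.+-identityʳ _)) ∷ []
  shuffles-size-length (x ∷ a) (y ∷ b) = AllP.++⁺
    (AllP.map⁺ (All.map (λ (size≡ , length≡) →
      ≡.trans (≡.cong (⟦ x ⟧ ℕ.+_) size≡) (≡.sym (ℕP.+-assoc ⟦ x ⟧ (size a) _)) , ≡.cong suc length≡)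
      (shuffles-size-length a (y ∷ b))))
    (AllP.map⁺ (All.map (λ (size≡ , length≡) →
      ≡.trans (≡.cong (⟦ y ⟧ ℕ.+_) size≡) (swap-middle ⟦ y ⟧ (⟦ x ⟧ ℕ.+ size a) (size b)) ,
      ≡.trans (≡.cong suc length≡) (≡.sym (ℕP.+-suc (suc (length a)) (length b))))
      (shuffles-size-length (x ∷ a) b)))
    where
    swap-middle : ∀ p q r → p ℕ.+ (q ℕ.+ r) ≡ q ℕ.+ (p ℕ.+ r)
    swap-middle = solve-∀

  invFact-! : ∀ n → ι commutativeRing (n !) * invFact n ≈ 1#
  invFact-! n = ι-inv (n !) {{n ℕP.!≢0}}

  binomial-invFact : ∀ N m n → N ℕ.* m ! ℕ.* n ! ≡ (m ℕ.+ n) ! → ι commutativeRing N * invFact (m ℕ.+ n) ≈ invFact m * invFact n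
  binomial-invFact N m n N·m!·n!≡ = begin
    lhs                ≈⟨ sym (*-identityʳ lhs) ⟩
    lhs * 1#           ≈⟨ *-congˡ (sym facts*rhs≈1) ⟩
    lhs * (facts * rhs) ≈⟨ sym (*-assoc _ _ _) ⟩
    (lhs * facts) * rhs ≈⟨ *-congʳ lhs*facts≈1 ⟩
    1# * rhs           ≈⟨ *-identityˡ rhs ⟩
    rhs                ∎
    where
    ι′ : ℕ → Carrier
    ι′ = ι commutativeRing
    lhs rhs facts : Carrier
    lhs   = ι′ N * invFact (m ℕ.+ n)
    rhs   = invFact m * invFact n
    facts = ι′ (m !) * ι′ (n !)
    facts*rhs≈1 : facts * rhs ≈ 1#
    facts*rhs≈1 = trans (*-interchange _ _ _ _) (trans (*-cong (invFact-! m) (invFact-! n)) (*-identityˡ _))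
    lhs*facts≈1 : lhs * facts ≈ 1#
    lhs*facts≈1 = begin
      (ι′ N * invFact (m ℕ.+ n)) * facts                   ≈⟨ trans (*-assoc _ _ _) (trans (*-congˡ (*-comm _ _)) (sym (*-assoc _ _ _))) ⟩
      (ι′ N * (ι′ (m !) * ι′ (n !))) * invFact (m ℕ.+ n)
        ≈⟨ *-congʳ (sym (trans (ι-* (N ℕ.* m !) (n !)) (trans (*-congʳ (ι-* N (m !))) (*-assoc _ _ _)))) ⟩
      ι′ (N ℕ.* m ! ℕ.* n !) * invFact (m ℕ.+ n)           ≈⟨ *-congʳ (reflexive (≡.cong ι′ N·m!·n!≡)) ⟩
      ι′ ((m ℕ.+ n) !) * invFact (m ℕ.+ n)                 ≈⟨ invFact-! (m ℕ.+ n) ⟩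
      1#                                                   ∎

  antidiagonal : ℕ → List (ℕ × ℕ)
  antidiagonal zero    = (0 , 0) ∷ []
  antidiagonal (suc m) = (0 , suc m) ∷ map (λ (i , j) → (suc i , j)) (antidiagonal m)

  binarySplits : ℕ⁺ → List (ℕ⁺ × ℕ⁺)
  binarySplits (1+ zero)    = []
  binarySplits (1+ (suc m)) = map (λ (i , j) → (1+ i , 1+ j)) (antidiagonal m)

  ∑-antidiagonal-indicator : ∀ m a b x y →
    ∑ (antidiagonal m) (λ p → χ (does (a ℕ.≟ proj₁ p)) x * χ (does (b ℕ.≟ proj₂ p)) y) ≈ χ (does (a ℕ.+ b ℕ.≟ m)) (x * y)
  ∑-antidiagonal-indicator zero    zero    zero    x y = +-identityʳ _
  ∑-antidiagonal-indicator zero    zero    (suc b) x y = trans (+-identityʳ _) (zeroʳ _)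
  ∑-antidiagonal-indicator zero    (suc a) b       x y = trans (+-identityʳ _) (zeroˡ _)
  ∑-antidiagonal-indicator (suc m) zero    b       x y =
    trans (+-cong (*-χ (does (b ℕ.≟ suc m)) x y)
                  (trans (reflexive (∑-map _ (antidiagonal m) _)) (trans (∑-cong (antidiagonal m) (λ _ → zeroˡ _)) (∑-zero (antidiagonal m)))))
          (+-identityʳ _)
  ∑-antidiagonal-indicator (suc m) (suc a) b       x y =
    trans (+-cong (zeroˡ _) (reflexive (∑-map _ (antidiagonal m) _))) (trans (+-identityˡ _) (∑-antidiagonal-indicator m a b x y))

  ∑-binarySplits-indicator : ∀ g a b x y →
    ∑ (binarySplits g) (λ p → χ (does (suc a ℕ.≟ ⟦ proj₁ p ⟧)) x * χ (does (suc b ℕ.≟ ⟦ proj₂ p ⟧)) y)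
      ≈ χ (does (suc a ℕ.+ suc b ℕ.≟ ⟦ g ⟧)) (x * y)
  ∑-binarySplits-indicator (1+ zero)    a b x y rewrite ℕP.+-suc a b = refl
  ∑-binarySplits-indicator (1+ (suc m)) a b x y rewrite ℕP.+-suc a b =
    trans (reflexive (∑-map _ (antidiagonal m) _)) (∑-antidiagonal-indicator m a b x y)

  antidiagonal-sum : ∀ m → All (λ p → proj₁ p ℕ.+ proj₂ p ≡ m) (antidiagonal m)
  antidiagonal-sum zero    = ≡.refl ∷ []
  antidiagonal-sum (suc m) = ≡.refl ∷ AllP.map⁺ (All.map (≡.cong suc) (antidiagonal-sum m))

  binarySplits-sum : ∀ g → All (λ p → ⟦ proj₁ p ⟧ ℕ.+ ⟦ proj₂ p ⟧ ≡ ⟦ g ⟧) (binarySplits g)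
  binarySplits-sum (1+ zero)    = []
  binarySplits-sum (1+ (suc m)) = AllP.map⁺ (All.map {P = λ p → proj₁ p ℕ.+ proj₂ p ≡ m}
    (λ {(i , j)} i+j≡m → ≡.cong suc (≡.trans (ℕP.+-suc i j) (≡.cong suc i+j≡m))) (antidiagonal-sum m))

  Ψ×⊗Ψ× : Comp × Comp → ISPW⊗ISPW
  Ψ×⊗Ψ× p = bilin (λ x y → (1# , (x , y)) ∷ []) (Ψ× (proj₁ p)) (Ψ× (proj₂ p))

  ⟨_∣Ψ×⊗Ψ×_⟩ : (Comp × Comp → Carrier) → Comp × Comp → Carrier
  ⟨ h ∣Ψ×⊗Ψ× p ⟩ = ⟨ (λ x → ⟨ (λ y → h (x , y)) ∣ Ψ× (proj₂ p) ⟩) ∣ Ψ× (proj₁ p) ⟩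

  pair-Ψ×⊗Ψ× : ∀ h p → ⟨ h ∣ Ψ×⊗Ψ× p ⟩ ≈ ⟨ h ∣Ψ×⊗Ψ× p ⟩
  pair-Ψ×⊗Ψ× h p = trans (pair-bilin (λ x y → (1# , (x , y)) ∷ []) (Ψ× (proj₁ p)) (Ψ× (proj₂ p)) h)
    (pair-cong (Ψ× (proj₁ p)) (λ x → pair-cong (Ψ× (proj₂ p)) (λ y → pair-singleton h (x , y))))

  coeff-Ψ×⊗Ψ× : ∀ a b p → ⟨ δ² (a , b) ∣Ψ×⊗Ψ× p ⟩ ≈ ⟨ δ a ∣ Ψ× (proj₁ p) ⟩ * ⟨ δ b ∣ Ψ× (proj₂ p) ⟩
  coeff-Ψ×⊗Ψ× a b p = begin
    ⟨ δ² (a , b) ∣Ψ×⊗Ψ× p ⟩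
      ≈⟨ pair-cong (Ψ× (proj₁ p)) (λ x → trans (pair-cong (Ψ× (proj₂ p)) (δ²-split a b x)) (pair-* (δ a x) (δ b) (Ψ× (proj₂ p)))) ⟩
    ⟨ (λ x → δ a x * ⟨ δ b ∣ Ψ× (proj₂ p) ⟩) ∣ Ψ× (proj₁ p) ⟩
      ≈⟨ trans (pair-cong (Ψ× (proj₁ p)) (λ x → *-comm _ _)) (pair-* _ (δ a) (Ψ× (proj₁ p))) ⟩
    ⟨ δ b ∣ Ψ× (proj₂ p) ⟩ * ⟨ δ a ∣ Ψ× (proj₁ p) ⟩
      ≈⟨ *-comm _ _ ⟩
    ⟨ δ a ∣ Ψ× (proj₁ p) ⟩ * ⟨ δ b ∣ Ψ× (proj₂ p) ⟩ ∎

  coeffP : ℕ⁺ → Comp → Carrier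
  coeffP x a = χ (does (size a ℕ.≟ ⟦ x ⟧)) (invFact (length a))

  coeff-Ψ×-single : ∀ x a → ⟨ δ a ∣ Ψ× (x ∷ []) ⟩ ≈ coeffP x a
  coeff-Ψ×-single (1+ k) a = begin
    ⟨ δ a ∣ mulW (P (suc k)) unitW ⟩                  ≈⟨ pair-mulW (δ a) (P (suc k)) unitW ⟩
    ⟨ (λ u → ⟨ (λ w → δ a (u ++ w)) ∣ unitW ⟩) ∣ P (suc k) ⟩
      ≈⟨ pair-cong (P (suc k)) (λ u → trans (pair-singleton (λ w → δ a (u ++ w)) []) (reflexive (≡.cong (δ a) (ListP.++-identityʳ u)))) ⟩
    ⟨ δ a ∣ P (suc k) ⟩                                ≈⟨ coeff-P k a ⟩
    coeffP (1+ k) a                                    ∎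

  ΔP-terms : ℕ⁺ → List (Comp × Comp)
  ΔP-terms g = (g ∷ [] , []) ∷ ([] , g ∷ []) ∷ map (λ (a , b) → (a ∷ [] , b ∷ [])) (binarySplits g)

  coeff-ΔP : ℕ⁺ → Comp → Comp → Carrier
  coeff-ΔP g a b = χ (does (size a ℕ.+ size b ℕ.≟ ⟦ g ⟧)) (invFact (length a) * invFact (length b))

  pair-splits-P : ∀ g a b → ⟨ (λ u → ∑ (splits u) (δ² (a , b))) ∣ P ⟦ g ⟧ ⟩ ≈ coeff-ΔP g a b
  pair-splits-P (1+ k) a b = begin
    ⟨ (λ u → ∑ (splits u) (δ² (a , b))) ∣ P (suc k) ⟩
      ≈⟨ P-expand k _ ⟩
    ∑ C (λ u → invFact (length u) * ∑ (splits u) (δ² (a , b)))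
      ≈⟨ ∑-cong C (λ u → *-congˡ (trans (∑-cong (splits u) (λ p → δ²-split a b (proj₁ p) (proj₂ p))) (splits-shuffles u a b))) ⟩
    ∑ C (λ u → invFact (length u) * ∑ Sh (δ u))
      ≈⟨ trans (∑-cong C (λ u → ∑-*ˡ Sh _ _)) (∑-comm C Sh _) ⟩
    ∑ Sh (λ w → ∑ C (λ u → invFact (length u) * δ u w))
      ≈⟨ ∑-cong Sh (λ w → ∑-cong C (λ u → trans (*-comm _ _) (*-congʳ (δ-sym u w)))) ⟩
    ∑ Sh (λ w → ∑ C (λ u → δ w u * invFact (length u)))
      ≈⟨ ∑-cong Sh (λ w → ∑-comps-δ-subst (suc k) w (λ u → invFact (length u))) ⟩
    ∑ Sh (λ w → χ (does (size w ℕ.≟ suc k)) (invFact (length w)))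
      ≈⟨ ∑-congᴬ (shuffles-size-length a b) (λ w (size≡ , length≡) →
           reflexive (≡.cong₂ (λ m n → χ (does (m ℕ.≟ suc k)) (invFact n)) size≡ length≡)) ⟩
    ∑ Sh (λ _ → χ sizes-match (invFact (length a ℕ.+ length b)))
      ≈⟨ ∑-const Sh _ ⟩
    ι commutativeRing (length Sh) * χ sizes-match (invFact (length a ℕ.+ length b))
      ≈⟨ *-χ sizes-match _ _ ⟩
    χ sizes-match (ι commutativeRing (length Sh) * invFact (length a ℕ.+ length b))
      ≈⟨ χ-cong sizes-match (binomial-invFact (length Sh) (length a) (length b) (length-shuffles a b)) ⟩
    coeff-ΔP (1+ k) a b ∎
    where
    C : List Comp
    C = comps (suc k)
    Sh : List Comp
    Sh = shuffles a b
    sizes-match : Bool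
    sizes-match = does (size a ℕ.+ size b ℕ.≟ suc k)

  private
    expand-ΔP-terms : ∀ g a b → ∑ (ΔP-terms g) ⟨ δ² (a , b) ∣Ψ×⊗Ψ×_⟩ ≈
      coeffP g a * δ b [] + (δ a [] * coeffP g b + ∑ (binarySplits g) (λ p → coeffP (proj₁ p) a * coeffP (proj₂ p) b))
    expand-ΔP-terms g a b =
      +-cong (trans (coeff-Ψ×⊗Ψ× a b (g ∷ [] , [])) (*-cong (coeff-Ψ×-single g a) (pair-singleton (δ b) [])))
     (+-cong (trans (coeff-Ψ×⊗Ψ× a b ([] , g ∷ [])) (*-cong (pair-singleton (δ a) []) (coeff-Ψ×-single g b)))
             (trans (reflexive (∑-map _ (binarySplits g) _))
                    (∑-cong (binarySplits g) (λ (x , y) →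
                      trans (coeff-Ψ×⊗Ψ× a b (x ∷ [] , y ∷ [])) (*-cong (coeff-Ψ×-single x a) (coeff-Ψ×-single y b))))))

    ∑-binarySplits-zero : ∀ g (f : ℕ⁺ × ℕ⁺ → Carrier) → (∀ p → f p ≈ 0#) → ∑ (binarySplits g) f ≈ 0#
    ∑-binarySplits-zero g f f≈0 = trans (∑-cong (binarySplits g) f≈0) (∑-zero (binarySplits g))

  ∑-ΔP-terms : ∀ g a b → ∑ (ΔP-terms g) ⟨ δ² (a , b) ∣Ψ×⊗Ψ×_⟩ ≈ coeff-ΔP g a b
  ∑-ΔP-terms (1+ k) [] [] = begin
    ∑ (ΔP-terms (1+ k)) ⟨ δ² ([] , []) ∣Ψ×⊗Ψ×_⟩
      ≈⟨ expand-ΔP-terms (1+ k) [] [] ⟩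
    0# * 1# + (1# * 0# + ∑ (binarySplits (1+ k)) (λ p → 0# * coeffP (proj₂ p) []))
      ≈⟨ +-cong (zeroˡ _) (+-cong (zeroʳ _) (∑-binarySplits-zero (1+ k) _ (λ _ → zeroˡ _))) ⟩
    0# + (0# + 0#)
      ≈⟨ trans (+-identityˡ _) (+-identityˡ _) ⟩
    0# ∎
  ∑-ΔP-terms (1+ k) [] (y ∷ b) = begin
    ∑ (ΔP-terms (1+ k)) ⟨ δ² ([] , (y ∷ b)) ∣Ψ×⊗Ψ×_⟩
      ≈⟨ expand-ΔP-terms (1+ k) [] (y ∷ b) ⟩
    0# * δ (y ∷ b) [] + (1# * coeffP (1+ k) (y ∷ b) + ∑ (binarySplits (1+ k)) (λ p → 0# * coeffP (proj₂ p) (y ∷ b)))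
      ≈⟨ +-cong (zeroˡ _) (+-cong (*-identityˡ _) (∑-binarySplits-zero (1+ k) _ (λ _ → zeroˡ _))) ⟩
    0# + (coeffP (1+ k) (y ∷ b) + 0#)
      ≈⟨ trans (+-identityˡ _) (+-identityʳ _) ⟩
    coeffP (1+ k) (y ∷ b)
      ≈⟨ χ-cong (does (size (y ∷ b) ℕ.≟ suc k)) (sym (trans (*-congʳ invFact-1) (*-identityˡ _))) ⟩
    coeff-ΔP (1+ k) [] (y ∷ b) ∎
  ∑-ΔP-terms (1+ k) (x ∷ a) [] = begin
    ∑ (ΔP-terms (1+ k)) ⟨ δ² ((x ∷ a) , []) ∣Ψ×⊗Ψ×_⟩
      ≈⟨ expand-ΔP-terms (1+ k) (x ∷ a) [] ⟩
    coeffP (1+ k) (x ∷ a) * 1# + (δ (x ∷ a) [] * 0# + ∑ (binarySplits (1+ k)) (λ p → coeffP (proj₁ p) (x ∷ a) * 0#))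
      ≈⟨ +-cong (*-identityʳ _) (+-cong (zeroʳ _) (∑-binarySplits-zero (1+ k) _ (λ _ → zeroʳ _))) ⟩
    coeffP (1+ k) (x ∷ a) + (0# + 0#)
      ≈⟨ trans (+-congˡ (+-identityˡ _)) (+-identityʳ _) ⟩
    coeffP (1+ k) (x ∷ a)
      ≈⟨ χ-cong (does (size (x ∷ a) ℕ.≟ suc k)) (sym (trans (*-congˡ invFact-1) (*-identityʳ _))) ⟩
    χ (does (size (x ∷ a) ℕ.≟ suc k)) (invFact (length (x ∷ a)) * invFact 0)
      ≡⟨ ≡.cong (λ m → χ (does (m ℕ.≟ suc k)) (invFact (length (x ∷ a)) * invFact 0)) (ℕP.+-identityʳ (size (x ∷ a))) ⟨
    coeff-ΔP (1+ k) (x ∷ a) [] ∎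
  ∑-ΔP-terms (1+ k) (x ∷ a) (y ∷ b) = begin
    ∑ (ΔP-terms (1+ k)) ⟨ δ² ((x ∷ a) , (y ∷ b)) ∣Ψ×⊗Ψ×_⟩
      ≈⟨ expand-ΔP-terms (1+ k) (x ∷ a) (y ∷ b) ⟩
    coeffP (1+ k) (x ∷ a) * δ (y ∷ b) [] + (δ (x ∷ a) [] * coeffP (1+ k) (y ∷ b) + ∑ (binarySplits (1+ k)) _)
      ≈⟨ +-cong (trans (*-congˡ (δ-∷-[] y b)) (zeroʳ _)) (+-congʳ (trans (*-congʳ (δ-∷-[] x a)) (zeroˡ _))) ⟩
    0# + (0# + ∑ (binarySplits (1+ k)) (λ p → coeffP (proj₁ p) (x ∷ a) * coeffP (proj₂ p) (y ∷ b)))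
      ≈⟨ trans (+-identityˡ _) (+-identityˡ _) ⟩
    ∑ (binarySplits (1+ k)) (λ p → coeffP (proj₁ p) (x ∷ a) * coeffP (proj₂ p) (y ∷ b))
      ≈⟨ ∑-binarySplits-indicator (1+ k) (ℕ.pred (size (x ∷ a))) (ℕ.pred (size (y ∷ b))) _ _ ⟩
    coeff-ΔP (1+ k) (x ∷ a) (y ∷ b) ∎

  pair-ΔW : ∀ h v → ⟨ h ∣ ΔW v ⟩ ≈ ⟨ (λ u → ∑ (splits u) h) ∣ v ⟩
  pair-ΔW h v = trans (pair-linext (λ β → map (1# ,_) (splits β)) v h)
                      (pair-cong v (λ u → pair-unit-coefficients h (splits u)))

  ΔW-P : ∀ g h → ⟨ (λ u → ∑ (splits u) h) ∣ P ⟦ g ⟧ ⟩ ≈ ∑ (ΔP-terms g) ⟨ h ∣Ψ×⊗Ψ×_⟩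
  ΔW-P g h = begin
    ⟨ (λ u → ∑ (splits u) h) ∣ P ⟦ g ⟧ ⟩ ≈⟨ pair-ΔW h (P ⟦ g ⟧) ⟨
    ⟨ h ∣ ΔW (P ⟦ g ⟧) ⟩                 ≈⟨ Coefficients.pair-resp-≈ᶜ _≟C²_ h (ΔW (P ⟦ g ⟧)) ΔP coefficients ⟩
    ⟨ h ∣ ΔP ⟩                           ≈⟨ pair-ΔP h ⟩
    ∑ (ΔP-terms g) ⟨ h ∣Ψ×⊗Ψ×_⟩         ∎
    where
    ΔP : ISPW⊗ISPW
    ΔP = linext Ψ×⊗Ψ× (map (1# ,_) (ΔP-terms g))
    pair-ΔP : ∀ h → ⟨ h ∣ ΔP ⟩ ≈ ∑ (ΔP-terms g) ⟨ h ∣Ψ×⊗Ψ×_⟩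
    pair-ΔP h = trans (pair-linext Ψ×⊗Ψ× (map (1# ,_) (ΔP-terms g)) h)
      (trans (pair-unit-coefficients (λ p → ⟨ h ∣ Ψ×⊗Ψ× p ⟩) (ΔP-terms g)) (∑-cong (ΔP-terms g) (pair-Ψ×⊗Ψ× h)))
    coefficients : Coefficients._≈ᶜ_ _≟C²_ (ΔW (P ⟦ g ⟧)) ΔP
    coefficients (a , b) = begin
      coeff _≟C²_ (ΔW (P ⟦ g ⟧)) (a , b)             ≈⟨ Coefficients.coeff-pair _≟C²_ (ΔW (P ⟦ g ⟧)) (a , b) ⟩
      ⟨ δ² (a , b) ∣ ΔW (P ⟦ g ⟧) ⟩                  ≈⟨ pair-ΔW (δ² (a , b)) (P ⟦ g ⟧) ⟩
      ⟨ (λ u → ∑ (splits u) (δ² (a , b))) ∣ P ⟦ g ⟧ ⟩ ≈⟨ pair-splits-P g a b ⟩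
      coeff-ΔP g a b                                  ≈⟨ ∑-ΔP-terms g a b ⟨
      ∑ (ΔP-terms g) ⟨ δ² (a , b) ∣Ψ×⊗Ψ×_⟩           ≈⟨ pair-ΔP (δ² (a , b)) ⟨
      ⟨ δ² (a , b) ∣ ΔP ⟩                            ≈⟨ Coefficients.coeff-pair _≟C²_ ΔP (a , b) ⟨
      coeff _≟C²_ ΔP (a , b)                         ∎

  _⊙_ : Comp × Comp → Comp × Comp → Comp × Comp
  p ⊙ q = (proj₁ p ++ proj₁ q , proj₂ p ++ proj₂ q)

  -- Each part of γ goes to the left, to the right, or is split as a + b between both sides.
  coproductTerms : Comp → List (Comp × Comp)
  coproductTerms []      = ([] , []) ∷ []
  coproductTerms (g ∷ γ) = concatMap (λ q → map (_⊙ q) (ΔP-terms g)) (coproductTerms γ)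

  ∑-splits-++ : ∀ a b h → ∑ (splits (a ++ b)) h ≈ ∑ (splits a) (λ p → ∑ (splits b) (λ q → h (p ⊙ q)))
  ∑-splits-++ []      b h = sym (+-identityʳ _)
  ∑-splits-++ (x ∷ a) b h = begin
    ∑ (splits (x ∷ (a ++ b))) h
      ≈⟨ ∑-concatMap _ (splits (a ++ b)) h ⟩
    ∑ (splits (a ++ b)) (λ p → h (x ∷ proj₁ p , proj₂ p) + (h (proj₁ p , x ∷ proj₂ p) + 0#))
      ≈⟨ ∑-splits-++ a b _ ⟩
    ∑ (splits a) (λ p → ∑ (splits b) (λ q →
      h (x ∷ (proj₁ p ++ proj₁ q) , proj₂ p ++ proj₂ q) + (h (proj₁ p ++ proj₁ q , x ∷ (proj₂ p ++ proj₂ q)) + 0#)))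
      ≈⟨ ∑-cong (splits a) (λ p → trans (∑-+ (splits b) _ _) (+-congˡ (trans (∑-+ (splits b) _ _) (+-congˡ (∑-zero (splits b)))))) ⟩
    ∑ (splits a) (λ p → ∑ (splits b) (λ q → h (x ∷ (proj₁ p ++ proj₁ q) , proj₂ p ++ proj₂ q))
                      + (∑ (splits b) (λ q → h (proj₁ p ++ proj₁ q , x ∷ (proj₂ p ++ proj₂ q))) + 0#))
      ≈⟨ ∑-concatMap _ (splits a) _ ⟨
    ∑ (splits (x ∷ a)) (λ p → ∑ (splits b) (λ q → h (p ⊙ q))) ∎

  pair-Ψ×⊗Ψ×-⊙ : ∀ p q h → ⟨ (λ s → ⟨ (λ r → h (s ⊙ r)) ∣Ψ×⊗Ψ× q ⟩) ∣Ψ×⊗Ψ× p ⟩ ≈ ⟨ h ∣Ψ×⊗Ψ× p ⊙ q ⟩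
  pair-Ψ×⊗Ψ×-⊙ (p₁ , p₂) (q₁ , q₂) h = sym (begin
    ⟨ (λ x → ⟨ (λ y → h (x , y)) ∣ Ψ× (p₂ ++ q₂) ⟩) ∣ Ψ× (p₁ ++ q₁) ⟩
      ≈⟨ pair-Ψ×-++ p₁ q₁ _ ⟩
    ⟨ (λ x → ⟨ (λ x′ → ⟨ (λ y → h (x ++ x′ , y)) ∣ Ψ× (p₂ ++ q₂) ⟩) ∣ Ψ× q₁ ⟩) ∣ Ψ× p₁ ⟩
      ≈⟨ pair-cong (Ψ× p₁) (λ x → pair-cong (Ψ× q₁) (λ x′ → pair-Ψ×-++ p₂ q₂ _)) ⟩
    ⟨ (λ x → ⟨ (λ x′ → ⟨ (λ y → ⟨ (λ y′ → h (x ++ x′ , y ++ y′)) ∣ Ψ× q₂ ⟩) ∣ Ψ× p₂ ⟩) ∣ Ψ× q₁ ⟩) ∣ Ψ× p₁ ⟩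
      ≈⟨ pair-cong (Ψ× p₁) (λ x → pair-comm (Ψ× q₁) (Ψ× p₂) _) ⟩
    ⟨ (λ x → ⟨ (λ y → ⟨ (λ x′ → ⟨ (λ y′ → h (x ++ x′ , y ++ y′)) ∣ Ψ× q₂ ⟩) ∣ Ψ× q₁ ⟩) ∣ Ψ× p₂ ⟩) ∣ Ψ× p₁ ⟩ ∎)

  ΔW-Ψ× : ∀ γ h → ⟨ (λ u → ∑ (splits u) h) ∣ Ψ× γ ⟩ ≈ ∑ (coproductTerms γ) ⟨ h ∣Ψ×⊗Ψ×_⟩
  ΔW-Ψ× []      h = trans (pair-singleton (λ u → ∑ (splits u) h) [])
    (+-congʳ (sym (trans (pair-singleton (λ x → ⟨ (λ y → h (x , y)) ∣ unitW ⟩) []) (pair-singleton (λ y → h ([] , y)) []))))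
  ΔW-Ψ× (g ∷ γ) h = begin
    ⟨ (λ u → ∑ (splits u) h) ∣ mulW (P ⟦ g ⟧) (Ψ× γ) ⟩
      ≈⟨ pair-mulW _ (P ⟦ g ⟧) (Ψ× γ) ⟩
    ⟨ (λ a → ⟨ (λ b → ∑ (splits (a ++ b)) h) ∣ Ψ× γ ⟩) ∣ P ⟦ g ⟧ ⟩
      ≈⟨ pair-cong (P ⟦ g ⟧) (λ a → pair-cong (Ψ× γ) (λ b → ∑-splits-++ a b h)) ⟩
    ⟨ (λ a → ⟨ (λ b → ∑ (splits a) (λ p → ∑ (splits b) (λ q → h (p ⊙ q)))) ∣ Ψ× γ ⟩) ∣ P ⟦ g ⟧ ⟩
      ≈⟨ pair-cong (P ⟦ g ⟧) (λ a → sym (∑-pair-comm (splits a) (Ψ× γ) _)) ⟩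
    ⟨ (λ a → ∑ (splits a) (λ p → ⟨ (λ b → ∑ (splits b) (λ q → h (p ⊙ q))) ∣ Ψ× γ ⟩)) ∣ P ⟦ g ⟧ ⟩
      ≈⟨ pair-cong (P ⟦ g ⟧) (λ a → ∑-cong (splits a) (λ p → ΔW-Ψ× γ (λ q → h (p ⊙ q)))) ⟩
    ⟨ (λ a → ∑ (splits a) h′) ∣ P ⟦ g ⟧ ⟩
      ≈⟨ ΔW-P g h′ ⟩
    ∑ (ΔP-terms g) ⟨ h′ ∣Ψ×⊗Ψ×_⟩
      ≈⟨ ∑-cong (ΔP-terms g) pull-out ⟩
    ∑ (ΔP-terms g) (λ p → ∑ (coproductTerms γ) (λ q → ⟨ h ∣Ψ×⊗Ψ× p ⊙ q ⟩))
      ≈⟨ ∑-comm (ΔP-terms g) (coproductTerms γ) _ ⟩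
    ∑ (coproductTerms γ) (λ q → ∑ (ΔP-terms g) (λ p → ⟨ h ∣Ψ×⊗Ψ× p ⊙ q ⟩))
      ≈⟨ ∑-cong (coproductTerms γ) (λ q → reflexive (∑-map (_⊙ q) (ΔP-terms g) ⟨ h ∣Ψ×⊗Ψ×_⟩)) ⟨
    ∑ (coproductTerms γ) (λ q → ∑ (map (_⊙ q) (ΔP-terms g)) ⟨ h ∣Ψ×⊗Ψ×_⟩)
      ≈⟨ ∑-concatMap _ (coproductTerms γ) _ ⟨
    ∑ (coproductTerms (g ∷ γ)) ⟨ h ∣Ψ×⊗Ψ×_⟩ ∎
    where
    h′ : Comp × Comp → Carrier
    h′ p = ∑ (coproductTerms γ) ⟨ (λ r → h (p ⊙ r)) ∣Ψ×⊗Ψ×_⟩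
    pull-out : ∀ p → ⟨ h′ ∣Ψ×⊗Ψ× p ⟩ ≈ ∑ (coproductTerms γ) (λ q → ⟨ h ∣Ψ×⊗Ψ× p ⊙ q ⟩)
    pull-out p = begin
      ⟨ h′ ∣Ψ×⊗Ψ× p ⟩
        ≈⟨ pair-cong (Ψ× (proj₁ p)) (λ x → sym (∑-pair-comm (coproductTerms γ) (Ψ× (proj₂ p)) _)) ⟩
      ⟨ (λ x → ∑ (coproductTerms γ) (λ q → ⟨ (λ y → ⟨ (λ r → h ((x , y) ⊙ r)) ∣Ψ×⊗Ψ× q ⟩) ∣ Ψ× (proj₂ p) ⟩)) ∣ Ψ× (proj₁ p) ⟩
        ≈⟨ ∑-pair-comm (coproductTerms γ) (Ψ× (proj₁ p)) _ ⟨
      ∑ (coproductTerms γ) (λ q → ⟨ (λ s → ⟨ (λ r → h (s ⊙ r)) ∣Ψ×⊗Ψ× q ⟩) ∣Ψ×⊗Ψ× p ⟩)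
        ≈⟨ ∑-cong (coproductTerms γ) (λ q → pair-Ψ×⊗Ψ×-⊙ p q h) ⟩
      ∑ (coproductTerms γ) (λ q → ⟨ h ∣Ψ×⊗Ψ× p ⊙ q ⟩) ∎

  ∑-coproductTerms-∷ : ∀ g γ (f : Comp × Comp → Carrier) → ∑ (coproductTerms (g ∷ γ)) f ≈
    ∑ (coproductTerms γ) (λ q → f (g ∷ proj₁ q , proj₂ q) + (f (proj₁ q , g ∷ proj₂ q)
                                + ∑ (binarySplits g) (λ p → f (proj₁ p ∷ proj₁ q , proj₂ p ∷ proj₂ q))))
  ∑-coproductTerms-∷ g γ f = trans (∑-concatMap _ (coproductTerms γ) f) (∑-cong (coproductTerms γ) (λ q →
    trans (reflexive (∑-map (_⊙ q) (ΔP-terms g) f))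
          (+-congˡ (+-congˡ (reflexive (∑-map (λ (a , b) → (a ∷ [] , b ∷ [])) (binarySplits g) (λ p → f (p ⊙ q))))))))

  ∑-binarySplits-δ⁺ : ∀ g x y → ∑ (binarySplits g) (λ p → δ⁺ x (proj₁ p) * δ⁺ y (proj₂ p)) ≈ δ⁺ g (1+ (ℕ.pred ⟦ x ⟧ ℕ.+ ⟦ y ⟧))
  ∑-binarySplits-δ⁺ g (1+ a) (1+ b) = begin
    ∑ (binarySplits g) (λ p → δ⁺ (1+ a) (proj₁ p) * δ⁺ (1+ b) (proj₂ p))
      ≈⟨ ∑-cong (binarySplits g) (λ p → *-cong (δ⁺-ℕ (1+ a) (proj₁ p)) (δ⁺-ℕ (1+ b) (proj₂ p))) ⟩
    ∑ (binarySplits g) (λ p → χ (does (suc a ℕ.≟ ⟦ proj₁ p ⟧)) 1# * χ (does (suc b ℕ.≟ ⟦ proj₂ p ⟧)) 1#)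
      ≈⟨ ∑-binarySplits-indicator g a b 1# 1# ⟩
    χ (does (suc a ℕ.+ suc b ℕ.≟ ⟦ g ⟧)) (1# * 1#)
      ≈⟨ χ-cong (does (suc a ℕ.+ suc b ℕ.≟ ⟦ g ⟧)) (*-identityˡ 1#) ⟩
    χ (does (suc a ℕ.+ suc b ℕ.≟ ⟦ g ⟧)) 1#
      ≈⟨ trans (δ⁺-sym g (1+ (a ℕ.+ suc b))) (δ⁺-ℕ (1+ (a ℕ.+ suc b)) g) ⟨
    δ⁺ g (1+ (a ℕ.+ suc b)) ∎

  quasiShuffles-step : ∀ g γ → (∀ α β → ∑ (qsh α β) (δ γ) ≈ ∑ (coproductTerms γ) (splitWeight α β)) →
                       ∀ α β → ∑ (qsh α β) (δ (g ∷ γ)) ≈ ∑ (coproductTerms (g ∷ γ)) (splitWeight α β)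
  quasiShuffles-step g γ IH [] [] = begin
    δ (g ∷ γ) [] + 0#
      ≈⟨ trans (+-identityʳ _) (δ-∷-[] g γ) ⟩
    0#
      ≈⟨ ∑-zero (coproductTerms γ) ⟨
    ∑ (coproductTerms γ) (λ _ → 0#)
      ≈⟨ ∑-cong (coproductTerms γ) (λ (l , r) → sym (trans
           (+-cong (weight-[]ˡ [] g l r) (+-cong (weight-[]ʳ [] g l r)
                   (∑-binarySplits-zero g _ (λ (a , b) → weight-[]ˡ [] a l (b ∷ r)))))
           (trans (+-identityˡ _) (+-identityˡ _)))) ⟩
    _
      ≈⟨ ∑-coproductTerms-∷ g γ (splitWeight [] []) ⟨
    ∑ (coproductTerms (g ∷ γ)) (splitWeight [] []) ∎
  quasiShuffles-step g γ IH [] (y ∷ β) = begin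
    δ (g ∷ γ) (y ∷ β) + 0#
      ≈⟨ trans (+-identityʳ _) (δ-∷ g γ y β) ⟩
    δ⁺ g y * δ γ β
      ≈⟨ *-congˡ (trans (sym (+-identityʳ _)) (IH [] β)) ⟩
    δ⁺ g y * ∑ (coproductTerms γ) (splitWeight [] β)
      ≈⟨ ∑-*ˡ (coproductTerms γ) _ _ ⟩
    ∑ (coproductTerms γ) (λ q → δ⁺ g y * splitWeight [] β q)
      ≈⟨ ∑-cong (coproductTerms γ) (λ (l , r) → sym (trans
           (+-cong (weight-[]ˡ (y ∷ β) g l r) (+-cong (weight-∷ʳ [] y β g l r)
                   (∑-binarySplits-zero g _ (λ (a , b) → weight-[]ˡ (y ∷ β) a l (b ∷ r)))))
           (trans (+-identityˡ _) (+-identityʳ _)))) ⟩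
    _
      ≈⟨ ∑-coproductTerms-∷ g γ (splitWeight [] (y ∷ β)) ⟨
    ∑ (coproductTerms (g ∷ γ)) (splitWeight [] (y ∷ β)) ∎
  quasiShuffles-step g γ IH (x ∷ α) [] = begin
    δ (g ∷ γ) (x ∷ α) + 0#
      ≈⟨ trans (+-identityʳ _) (δ-∷ g γ x α) ⟩
    δ⁺ g x * δ γ α
      ≈⟨ *-congˡ (trans (sym (trans (reflexive (≡.cong (λ ws → ∑ ws (δ γ)) (qsh-[]ʳ α))) (+-identityʳ _))) (IH α [])) ⟩
    δ⁺ g x * ∑ (coproductTerms γ) (splitWeight α [])
      ≈⟨ ∑-*ˡ (coproductTerms γ) _ _ ⟩
    ∑ (coproductTerms γ) (λ q → δ⁺ g x * splitWeight α [] q)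
      ≈⟨ ∑-cong (coproductTerms γ) (λ (l , r) → sym (trans
           (+-cong (weight-∷ˡ x α [] g l r) (+-cong (weight-[]ʳ (x ∷ α) g l r)
                   (∑-binarySplits-zero g _ (λ (a , b) → weight-[]ʳ (x ∷ α) b (a ∷ l) r))))
           (trans (+-congˡ (+-identityˡ _)) (+-identityʳ _)))) ⟩
    _
      ≈⟨ ∑-coproductTerms-∷ g γ (splitWeight (x ∷ α) []) ⟨
    ∑ (coproductTerms (g ∷ γ)) (splitWeight (x ∷ α) []) ∎
    where
    qsh-[]ʳ : ∀ α → qsh α [] ≡ α ∷ []
    qsh-[]ʳ []      = ≡.refl
    qsh-[]ʳ (_ ∷ _) = ≡.refl
  quasiShuffles-step g γ IH (x ∷ α) (y ∷ β) = begin
    ∑ (qsh (x ∷ α) (y ∷ β)) (δ (g ∷ γ))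
      ≈⟨ trans (∑-++ (map (x ∷_) (qsh α (y ∷ β))) _ _) (+-congˡ (∑-++ (map (y ∷_) (qsh (x ∷ α) β)) _ _)) ⟩
    ∑ (map (x ∷_) (qsh α (y ∷ β))) (δ (g ∷ γ)) + (∑ (map (y ∷_) (qsh (x ∷ α) β)) (δ (g ∷ γ)) + ∑ (map (z ∷_) (qsh α β)) (δ (g ∷ γ)))
      ≈⟨ +-cong (∑-map-∷-δ g γ x (qsh α (y ∷ β))) (+-cong (∑-map-∷-δ g γ y (qsh (x ∷ α) β)) (∑-map-∷-δ g γ z (qsh α β))) ⟩
    δ⁺ g x * ∑ (qsh α (y ∷ β)) (δ γ) + (δ⁺ g y * ∑ (qsh (x ∷ α) β) (δ γ) + δ⁺ g z * ∑ (qsh α β) (δ γ))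
      ≈⟨ +-cong (*-congˡ (IH α (y ∷ β))) (+-cong (*-congˡ (IH (x ∷ α) β)) (*-congˡ (IH α β))) ⟩
    δ⁺ g x * ∑ T (splitWeight α (y ∷ β)) + (δ⁺ g y * ∑ T (splitWeight (x ∷ α) β) + δ⁺ g z * ∑ T (splitWeight α β))
      ≈⟨ +-cong (∑-*ˡ T _ _) (+-cong (∑-*ˡ T _ _) (∑-*ˡ T _ _)) ⟩
    ∑ T (λ q → δ⁺ g x * splitWeight α (y ∷ β) q) + (∑ T (λ q → δ⁺ g y * splitWeight (x ∷ α) β q) + ∑ T (λ q → δ⁺ g z * splitWeight α β q))
      ≈⟨ trans (∑-+ T _ _) (+-congˡ (∑-+ T _ _)) ⟨
    ∑ T (λ q → δ⁺ g x * splitWeight α (y ∷ β) q + (δ⁺ g y * splitWeight (x ∷ α) β q + δ⁺ g z * splitWeight α β q))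
      ≈⟨ ∑-cong T (λ (l , r) → sym (+-cong (weight-∷ˡ x α (y ∷ β) g l r) (+-cong (weight-∷ʳ (x ∷ α) y β g l r) (merged l r)))) ⟩
    _
      ≈⟨ ∑-coproductTerms-∷ g γ (splitWeight (x ∷ α) (y ∷ β)) ⟨
    ∑ (coproductTerms (g ∷ γ)) (splitWeight (x ∷ α) (y ∷ β)) ∎
    where
    z : ℕ⁺
    z = 1+ (ℕ.pred ⟦ x ⟧ ℕ.+ ⟦ y ⟧)
    T : List (Comp × Comp)
    T = coproductTerms γ
    merged : ∀ l r → ∑ (binarySplits g) (λ p → splitWeight (x ∷ α) (y ∷ β) (proj₁ p ∷ l , proj₂ p ∷ r)) ≈ δ⁺ g z * splitWeight α β (l , r)
    merged l r = begin
      ∑ (binarySplits g) (λ p → splitWeight (x ∷ α) (y ∷ β) (proj₁ p ∷ l , proj₂ p ∷ r))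
        ≈⟨ ∑-cong (binarySplits g) (λ p → trans (*-cong (δ-∷ x α (proj₁ p) l) (δ-∷ y β (proj₂ p) r)) (*-interchange _ _ _ _)) ⟩
      ∑ (binarySplits g) (λ p → (δ⁺ x (proj₁ p) * δ⁺ y (proj₂ p)) * splitWeight α β (l , r))
        ≈⟨ ∑-*ʳ (binarySplits g) _ _ ⟨
      ∑ (binarySplits g) (λ p → δ⁺ x (proj₁ p) * δ⁺ y (proj₂ p)) * splitWeight α β (l , r)
        ≈⟨ *-congʳ (∑-binarySplits-δ⁺ g x y) ⟩
      δ⁺ g z * splitWeight α β (l , r) ∎

  quasiShuffles-count : ∀ γ α β → ∑ (qsh α β) (δ γ) ≈ ∑ (coproductTerms γ) (splitWeight α β)
  quasiShuffles-count [] [] [] = +-congʳ (sym (trans (*-cong (δ-refl []) (δ-refl [])) (*-identityˡ _)))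
  quasiShuffles-count [] [] (y ∷ β) = +-congʳ (trans (δ-[]-∷ y β) (sym (trans (*-congˡ (δ-∷-[] y β)) (zeroʳ _))))
  quasiShuffles-count [] (x ∷ α) [] = +-congʳ (trans (δ-[]-∷ x α) (sym (trans (*-congʳ (δ-∷-[] x α)) (zeroˡ _))))
  quasiShuffles-count [] (x ∷ α) (y ∷ β) = begin
    ∑ (qsh (x ∷ α) (y ∷ β)) (δ [])
      ≈⟨ trans (∑-++ (map (x ∷_) (qsh α (y ∷ β))) _ _) (+-congˡ (∑-++ (map (y ∷_) (qsh (x ∷ α) β)) _ _)) ⟩
    _ ≈⟨ +-cong (∑-map-∷-δ[] x (qsh α (y ∷ β))) (+-cong (∑-map-∷-δ[] y (qsh (x ∷ α) β)) (∑-map-∷-δ[] _ (qsh α β))) ⟩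
    0# + (0# + 0#)
      ≈⟨ trans (+-identityˡ _) (+-identityˡ _) ⟩
    0#
      ≈⟨ trans (+-identityʳ _) (trans (*-congʳ (δ-∷-[] x α)) (zeroˡ _)) ⟨
    ∑ (coproductTerms []) (splitWeight (x ∷ α) (y ∷ β)) ∎
  quasiShuffles-count (g ∷ γ) α β = quasiShuffles-step g γ (quasiShuffles-count γ) α β

  ι-countC : ∀ γ ws → ι commutativeRing (countC γ ws) ≈ ∑ ws (δ γ)
  ι-countC γ []       = refl
  ι-countC γ (w ∷ ws) with γ ≟C w
  ... | yes ≡.refl = +-cong (sym (δ-refl γ)) (ι-countC γ ws)
  ... | no γ≢w     = trans (ι-countC γ ws) (sym (trans (+-congʳ (δ-≢ γ w γ≢w)) (+-identityˡ _)))

  ΔP-terms-size : ∀ g → All (λ p → size (proj₁ p) ℕ.+ size (proj₂ p) ≡ ⟦ g ⟧) (ΔP-terms g)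
  ΔP-terms-size g = ≡.trans (ℕP.+-identityʳ _) (ℕP.+-identityʳ _) ∷ ℕP.+-identityʳ _ ∷
    AllP.map⁺ (All.map (λ {(a , b)} a+b≡g → ≡.trans (≡.cong₂ ℕ._+_ (ℕP.+-identityʳ ⟦ a ⟧) (ℕP.+-identityʳ ⟦ b ⟧)) a+b≡g)
                       (binarySplits-sum g))

  coproductTerms-size : ∀ γ → All (λ p → size (proj₁ p) ℕ.+ size (proj₂ p) ≡ size γ) (coproductTerms γ)
  coproductTerms-size []      = ≡.refl ∷ []
  coproductTerms-size (g ∷ γ) = all-concatMap⁺ (λ {q} q≡γ → AllP.map⁺ (All.map (λ {p} p≡g →
      ≡.trans (≡.cong₂ ℕ._+_ (size-++ (proj₁ p) (proj₁ q)) (size-++ (proj₂ p) (proj₂ q)))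
              (≡.trans (interchange (size (proj₁ p)) (size (proj₁ q)) (size (proj₂ p)) (size (proj₂ q)))
                       (≡.cong₂ ℕ._+_ p≡g q≡γ)))
      (ΔP-terms-size g)))
    (coproductTerms-size γ)
    where
    interchange : ∀ a b c d → (a ℕ.+ b) ℕ.+ (c ℕ.+ d) ≡ (a ℕ.+ c) ℕ.+ (b ℕ.+ d)
    interchange = solve-∀

  ∑-sizes-splitWeight : ∀ n p → size (proj₁ p) ℕ.+ size (proj₂ p) ≡ n →
    ∑ (range 0 n) (λ a → ∑ (comps a) (λ α → ∑ (comps (n ∸ a)) (λ β → splitWeight α β p))) ≈ 1#
  ∑-sizes-splitWeight n (l , r) l+r≡n = begin
    ∑ (range 0 n) (λ a → ∑ (comps a) (λ α → ∑ (comps (n ∸ a)) (λ β → δ α l * δ β r)))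
      ≈⟨ ∑-cong (range 0 n) (λ a → ∑-cong (comps a) (λ α → trans (sym (∑-*ˡ (comps (n ∸ a)) _ _))
           (*-congˡ (trans (∑-cong (comps (n ∸ a)) (λ β → δ-sym β r)) (∑-comps-δ (n ∸ a) r))))) ⟩
    ∑ (range 0 n) (λ a → ∑ (comps a) (λ α → δ α l * χ (does (size r ℕ.≟ n ∸ a)) 1#))
      ≈⟨ ∑-cong (range 0 n) (λ a → trans (∑-cong (comps a) (λ α → *-congʳ (δ-sym α l)))
           (∑-comps-δ-subst a l (λ _ → χ (does (size r ℕ.≟ n ∸ a)) 1#))) ⟩
    ∑ (range 0 n) (λ a → χ (does (size l ℕ.≟ a)) (χ (does (size r ℕ.≟ n ∸ a)) 1#))
      ≈⟨ ∑-cong (range 0 n) (λ a → χ-subst ℕ._≟_ (size l) a (λ a → χ (does (size r ℕ.≟ n ∸ a)) 1#)) ⟩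
    ∑ (range 0 n) (λ a → χ (does (size l ℕ.≟ a)) (χ (does (size r ℕ.≟ n ∸ size l)) 1#))
      ≈⟨ ∑-range-indicator 0 n (size l) _ z≤n (≡.subst (size l ≤_) l+r≡n (ℕP.m≤m+n (size l) (size r))) ⟩
    χ (does (size r ℕ.≟ n ∸ size l)) 1#
      ≡⟨ ≡.cong (λ b → χ b 1#) (dec-true (size r ℕ.≟ n ∸ size l) r≡n∸l) ⟩
    1# ∎
    where
    r≡n∸l : size r ≡ n ∸ size l
    r≡n∸l = ≡.trans (≡.sym (ℕP.m+n∸m≡n (size l) (size r))) (≡.cong (_∸ size l) l+r≡n)

  pair-ΔN-basis : ∀ γ f → ⟨ f ∣ ΔN-basis γ ⟩ ≈ ∑ (coproductTerms γ) f
  pair-ΔN-basis γ f = begin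
    ⟨ f ∣ ΔN-basis γ ⟩
      ≈⟨ pair-concatMap (λ a → concatMap (λ α → map (λ β → (ι′ (countC γ (qsh α β)) , (α , β))) (comps (n ∸ a))) (comps a)) (range 0 n) f ⟩
    ∑ (range 0 n) (λ a → ⟨ f ∣ concatMap (λ α → map (λ β → (ι′ (countC γ (qsh α β)) , (α , β))) (comps (n ∸ a))) (comps a) ⟩)
      ≈⟨ ∑-cong (range 0 n) (λ a → trans (pair-concatMap (λ α → map (λ β → (ι′ (countC γ (qsh α β)) , (α , β))) (comps (n ∸ a))) (comps a) f)
           (∑-cong (comps a) (λ α → reflexive (∑-map (λ β → (ι′ (countC γ (qsh α β)) , (α , β))) (comps (n ∸ a)) _)))) ⟩
    ∑ (range 0 n) (λ a → ∑ (comps a) (λ α → ∑ (comps (n ∸ a)) (λ β → ι′ (countC γ (qsh α β)) * f (α , β))))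
      ≈⟨ ∑-cong (range 0 n) (λ a → ∑-cong (comps a) (λ α → ∑-cong (comps (n ∸ a)) (λ β → count-as-sum α β))) ⟩
    ∑ (range 0 n) (λ a → ∑ (comps a) (λ α → ∑ (comps (n ∸ a)) (λ β → ∑ T (λ p → f p * splitWeight α β p))))
      ≈⟨ ∑-cong (range 0 n) (λ a → ∑-cong (comps a) (λ α → pull (comps (n ∸ a)) _)) ⟩
    ∑ (range 0 n) (λ a → ∑ (comps a) (λ α → ∑ T (λ p → f p * ∑ (comps (n ∸ a)) (λ β → splitWeight α β p))))
      ≈⟨ ∑-cong (range 0 n) (λ a → pull (comps a) _) ⟩
    ∑ (range 0 n) (λ a → ∑ T (λ p → f p * ∑ (comps a) (λ α → ∑ (comps (n ∸ a)) (λ β → splitWeight α β p))))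
      ≈⟨ pull (range 0 n) _ ⟩
    ∑ T (λ p → f p * ∑ (range 0 n) (λ a → ∑ (comps a) (λ α → ∑ (comps (n ∸ a)) (λ β → splitWeight α β p))))
      ≈⟨ ∑-congᴬ (coproductTerms-size γ) (λ p sizes≡ → trans (*-congˡ (∑-sizes-splitWeight n p sizes≡)) (*-identityʳ _)) ⟩
    ∑ T f ∎
    where
    n : ℕ
    n = size γ
    T : List (Comp × Comp)
    T = coproductTerms γ
    ι′ : ℕ → Carrier
    ι′ = ι commutativeRing
    pull : ∀ {A : Set} (xs : List A) (k : A → Comp × Comp → Carrier) →
           ∑ xs (λ x → ∑ T (λ p → f p * k x p)) ≈ ∑ T (λ p → f p * ∑ xs (λ x → k x p))
    pull xs k = trans (∑-comm xs T _) (∑-cong T (λ p → sym (∑-*ˡ xs (f p) _)))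
    count-as-sum : ∀ α β → ι′ (countC γ (qsh α β)) * f (α , β) ≈ ∑ T (λ p → f p * splitWeight α β p)
    count-as-sum α β = begin
      ι′ (countC γ (qsh α β)) * f (α , β)        ≈⟨ *-congʳ (trans (ι-countC γ (qsh α β)) (quasiShuffles-count γ α β)) ⟩
      ∑ T (splitWeight α β) * f (α , β)          ≈⟨ ∑-*ʳ T _ _ ⟩
      ∑ T (λ p → splitWeight α β p * f (α , β))  ≈⟨ ∑-cong T (λ p → begin
          splitWeight α β p * f (α , β)      ≈⟨ *-congʳ (δ²-split α β (proj₁ p) (proj₂ p)) ⟨
          δ² (α , β) p * f (α , β)           ≈⟨ Coefficients.δ-subst _≟C²_ (α , β) p f ⟨
          δ² (α , β) p * f p                 ≈⟨ trans (*-congʳ (δ²-split α β (proj₁ p) (proj₂ p))) (*-comm _ _) ⟩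
          f p * splitWeight α β p            ∎) ⟩
      ∑ T (λ p → f p * splitWeight α β p)        ∎

  pair-Ψ*⊗Ψ* : ∀ h Y → ⟨ h ∣ Ψ*⊗Ψ* Y ⟩ ≈ ⟨ ⟨ h ∣Ψ×⊗Ψ×_⟩ ∣ Y ⟩
  pair-Ψ*⊗Ψ* h Y = trans (pair-linext _ Y h) (pair-cong Y (λ (a , b) → begin
    ⟨ h ∣ bilin (λ x y → (1# , (x , y)) ∷ []) (Ψ*-basis a) (Ψ*-basis b) ⟩
      ≈⟨ pair-bilin (λ x y → (1# , (x , y)) ∷ []) (Ψ*-basis a) (Ψ*-basis b) h ⟩
    ⟨ (λ x → ⟨ (λ y → ⟨ h ∣ (1# , (x , y)) ∷ [] ⟩) ∣ Ψ*-basis b ⟩) ∣ Ψ*-basis a ⟩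
      ≈⟨ pair-cong (Ψ*-basis a) (λ x → trans (pair-cong (Ψ*-basis b) (λ y → pair-singleton h (x , y))) (pair-Ψ*-basis b _)) ⟩
    ⟨ (λ x → ⟨ (λ y → h (x , y)) ∣ Ψ× b ⟩) ∣ Ψ*-basis a ⟩
      ≈⟨ pair-Ψ*-basis a _ ⟩
    ⟨ h ∣Ψ×⊗Ψ× (a , b) ⟩ ∎))

  Ψ*-Δ : ∀ v → ΔW (Ψ* v) ≋⊗ Ψ*⊗Ψ* (ΔN v)
  Ψ*-Δ v = Coefficients.≈ᶜ-from-pair _≟C²_ (ΔW (Ψ* v)) (Ψ*⊗Ψ* (ΔN v)) λ h → begin
    ⟨ h ∣ ΔW (Ψ* v) ⟩                                   ≈⟨ pair-ΔW h (Ψ* v) ⟩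
    ⟨ (λ u → ∑ (splits u) h) ∣ Ψ* v ⟩                   ≈⟨ pair-Ψ* _ v ⟩
    ⟨ (λ γ → ⟨ (λ u → ∑ (splits u) h) ∣ Ψ× γ ⟩) ∣ v ⟩   ≈⟨ pair-cong v (λ γ → ΔW-Ψ× γ h) ⟩
    ⟨ (λ γ → ∑ (coproductTerms γ) ⟨ h ∣Ψ×⊗Ψ×_⟩) ∣ v ⟩  ≈⟨ pair-cong v (λ γ → pair-ΔN-basis γ ⟨ h ∣Ψ×⊗Ψ×_⟩) ⟨
    ⟨ (λ γ → ⟨ ⟨ h ∣Ψ×⊗Ψ×_⟩ ∣ ΔN-basis γ ⟩) ∣ v ⟩      ≈⟨ pair-linext ΔN-basis v _ ⟨
    ⟨ ⟨ h ∣Ψ×⊗Ψ×_⟩ ∣ ΔN v ⟩                             ≈⟨ pair-Ψ*⊗Ψ* h (ΔN v) ⟨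
    ⟨ h ∣ Ψ*⊗Ψ* (ΔN v) ⟩                                ∎

mainTheorem20 :
    ∀ {c ℓ : Level} (F : CharZeroField c ℓ) →
      let open CharZeroField F using (_≈_) in
      let open Hopf F in
        -- Ψ* is a well-defined linear map NSym → ISPW ...
        (∀ v w → v ≋ w → Ψ* v ≋ Ψ* w)
        -- ... which is bijective ...
      × (∀ v w → Ψ* v ≋ Ψ* w → v ≋ w)
      × (∀ (w : ISPW) → Σ NSym (λ v → Ψ* v ≋ w))
        -- ... and a morphism of Hopf algebras (unit, product, counit, coproduct)
      × (Ψ* unitN ≋ unitW)
      × (∀ v w → Ψ* (mulN v w) ≋ mulW (Ψ* v) (Ψ* w))
      × (∀ v → counitW (Ψ* v) ≈ counitN v)
      × (∀ v → ΔW (Ψ* v) ≋⊗ Ψ*⊗Ψ* (ΔN v))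
mainTheorem20 F =
  Ψ*-cong , Ψ*-injective , (λ w → Ψ⁻¹ w , Ψ*-Ψ⁻¹ w) , Ψ*-unit , Ψ*-mul , Ψ*-counit , Ψ*-Δ
  where
  open ProductForm F
  open Triangularity F
  open Coproduct F
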